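{- Let $\mathcal{F}$ be the free non-symmetric operad on two binary generators $\alpha,\beta$, and let $\pi:\mathcal{F}\to\mathrm{CNCB}$ be the operad morphism with $\pi(\alpha)=\tau_{baa}$ and $\pi(\beta)=\tau_{aba}$. Then $\pi$ induces an isomorphism from $\mathcal{F}/_{\equiv}$ onto the suboperad $\langle\tau_{baa},\tau_{aba}\rangle$, where $\equiv$ is the smallest operad congruence of $\mathcal{F}$ containing $\beta\circ_1\beta\equiv\beta\circ_2\beta$ and $\alpha\circ_1\alpha\equiv\alpha\circ_2\beta$.
   Context: A bicoloured noncrossing configuration (BNC) of size $n\ge2$ is a regular polygon with vertices $1,\dots,n+1$ (clockwise) with each arc $(i,j)$, $1\le i<j\le n+1$, coloured blue, red or uncoloured, such that no two coloured (blue or red) arcs cross and red arcs are diagonals. The edges are $(i,i+1)$ for $i\in[n]$ (the $i$-th edge), the base is $(1,n+1)$, and the other arcs are diagonals. There is also a unique BNC of size $1$, a single blue arc (its edge and base). $\mathrm{CNCB}$ is the non-symmetric operad of BNCs (arity = size, unit = the size-$1$ BNC) with composition $\mathfrak{C}\circ_i\mathfrak{D}$ ($\mathfrak{C}$ of size $n$, $\mathfrak{D}$ of size $m$) obtained by gluing the base of $\mathfrak{D}$ onto the $i$-th edge of $\mathfrak{C}$. Vertex $j$ of $\mathfrak{C}$ goes to $j$ if $j\le i$ and to $j+m-1$ otherwise, and vertex $\ell$ of $\mathfrak{D}$ goes to $i+\ell-1$. All other arcs keep their colours. The arc $(i,i+m)$ is red if the $i$-th edge of $\mathfrak{C}$ and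 the base of $\mathfrak{D}$ are both uncoloured, blue if both are blue, and uncoloured otherwise. All remaining arcs are uncoloured. For $x,y,z\in\{a,b\}$, $\tau_{xyz}$ is the BNC of size $2$ (a triangle, which has no diagonals) whose first edge $(1,2)$, base $(1,3)$ and second edge $(2,3)$ are respectively coloured $x,y,z$, where $a$ means blue and $b$ means uncoloured. $\langle G\rangle$ denotes the smallest suboperad of $\mathrm{CNCB}$ containing $G$. -}

module Defs where

open import Data.Nat using (ℕ; zero; suc; _+_; _∸_; _≤_; _<_; _≤ᵇ_; _≡ᵇ_)
open import Data.Bool using (Bool; true; false; if_then_else_; _∧_; _∨_)
open import Data.Product using (Σ; _×_; _,_)
open import Relation.Binary.PropositionalEquality using (_≡_)

data Colour : Set where
  blue red none : Colour

-- (Raw) bicoloured configurations.  A configuration of size n has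
-- vertices 1 .. n+1; col i j is the colour of the arc (i,j) for
-- 1 ≤ i < j ≤ n+1 (values outside this range are irrelevant).

record Config : Set where
  constructor mkConfig
  field
    size : ℕ
    col  : ℕ → ℕ → Colour
open Config public

IsArc : ℕ → ℕ → ℕ → Set
IsArc n i j = (1 ≤ i) × (i < j) × (j ≤ suc n)

_≐_ : Config → Config → Set
C ≐ D = (size C ≡ size D) × (∀ i j → IsArc (size C) i j → col C i j ≡ col D i j)

-- Composition in CNCB: C ∘[ i ] D glues the base of D onto the i-th
-- edge of C (meaningful for 1 ≤ i ≤ size C, size D ≥ 1).

-- colour of the arc (i, i+m) in the composite
glue : Colour → Colour → Colour
glue none none = red
glue blue blue = blue
glue _    _    = none

_∘[_]_ : Config → ℕ → Config → Config
C ∘[ i ] D = mkConfig (size C + size D ∸ 1) c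
  where
  m : ℕ
  m = size D
  inC : ℕ → Bool
  inC p = (p ≤ᵇ i) ∨ ((i + m) ≤ᵇ p)
  -- preimage in C of a vertex in the image of C
  backC : ℕ → ℕ
  backC p = if p ≤ᵇ i then p else p ∸ (m ∸ 1)
  inD : ℕ → Bool
  inD p = (i ≤ᵇ p) ∧ (p ≤ᵇ (i + m))
  c : ℕ → ℕ → Colour
  c p q =
    if (p ≡ᵇ i) ∧ (q ≡ᵇ (i + m))
      then glue (col C i (suc i)) (col D 1 (suc m))
      else (if inC p ∧ inC q
        then col C (backC p) (backC q)
        else (if inD p ∧ inD q
          then col D (suc (p ∸ i)) (suc (q ∸ i))
          else none))

unitC : Config
unitC = mkConfig 1 c
  where
  c : ℕ → ℕ → Colour
  c 1 2 = blue
  c _ _ = none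

data AB : Set where
  a b : AB

⟦_⟧ab : AB → Colour
⟦ a ⟧ab = blue
⟦ b ⟧ab = none

-- τ x y z : triangle with first edge (1,2), base (1,3), second edge (2,3)
-- coloured x, y, z respectively
τ : AB → AB → AB → Config
τ x y z = mkConfig 2 c
  where
  c : ℕ → ℕ → Colour
  c 1 2 = ⟦ x ⟧ab
  c 1 3 = ⟦ y ⟧ab
  c 2 3 = ⟦ z ⟧ab
  c _ _ = none

data InGen : Config → Set where
  gen-unit : InGen unitC
  gen-baa  : InGen (τ b a a)
  gen-aba  : InGen (τ a b a)
  gen-comp : ∀ {C D} i → 1 ≤ i → i ≤ size C →
             InGen C → InGen D → InGen (C ∘[ i ] D)

data Gen₂ : Set where
  α β : Gen₂

data Tree : Set where
  leaf : Tree
  node : Gen₂ → Tree → Tree → Tree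

arity : Tree → ℕ
arity leaf         = 1
arity (node _ l r) = arity l + arity r

-- partial composition s ∘ᵢ t (1-based i; meaningful for 1 ≤ i ≤ arity s)
graft : Tree → ℕ → Tree → Tree
graft leaf         1 u = u
graft leaf         _ u = leaf
graft (node g l r) i u =
  if i ≤ᵇ arity l then node g (graft l i u) r
                  else node g l (graft r (i ∸ arity l) u)

gen : Gen₂ → Tree
gen g = node g leaf leaf

data _≈_ : Tree → Tree → Set where
  ax-β   : graft (gen β) 1 (gen β) ≈ graft (gen β) 2 (gen β)
  ax-α   : graft (gen α) 1 (gen α) ≈ graft (gen α) 2 (gen β)
  ≈-refl : ∀ {s} → s ≈ s
  ≈-sym  : ∀ {s t} → s ≈ t → t ≈ s
  ≈-trans : ∀ {s t u} → s ≈ t → t ≈ u → s ≈ u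
  ≈-comp : ∀ {s s' t t'} i → 1 ≤ i → i ≤ arity s →
           s ≈ s' → t ≈ t' → graft s i t ≈ graft s' i t'

πgen : Gen₂ → Config
πgen α = τ b a a
πgen β = τ a b a

π : Tree → Config
π leaf         = unitC
π (node g l r) = (πgen g ∘[ 1 ] π l) ∘[ suc (arity l) ] π r

-- Composition in CNCB is analysed arc by arc: every arc of C ∘[ i ] D either comes
-- from C, comes from D, is the glued arc, or crosses the glued arc and is uncoloured.
-- This gives the unit and the parallel and sequential associativity laws, so π is an
-- operad morphism; it respects ≡ because both sides of each relation are sent to the
-- same configuration. Orienting the relations from left to right, every tree is
-- ≡-equivalent to a normal one, in which no node has a left child carrying the same
-- generator. π is injective on normal trees: the root generator is read off the colour
-- of the base, and the size of the left subtree is recovered because in a normal tree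
-- the arc from vertex 1 to the last vertex of the left subtree is coloured, while the
-- arcs from 1 into the right subtree are not. Hence π s ≐ π t forces s and t to have
-- equal normal forms. Conversely, every configuration generated by τ_baa and τ_aba is
-- the image of the tree assembled by the same compositions.

module Submission where

open import Defs
open import Data.Bool using (Bool; true; false; if_then_else_; _∧_; _∨_; T)
open import Data.Bool.Properties using (T-≡)
open import Data.Empty using (⊥; ⊥-elim)
open import Data.Nat
open import Data.Nat.Properties
open import Algebra.Properties.CommutativeSemigroup +-commutativeSemigroup using (xy∙z≈xz∙y)
open import Data.Product using (Σ; _×_; _,_; proj₁; proj₂)
open import Data.Sum using (_⊎_; inj₁; inj₂)
open import Data.Unit using (⊤; tt)
open import Function using (_∘_; Equivalence)
open import Level using (0ℓ)
open import Relation.Binary.Bundles using (Setoid)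
open import Relation.Binary.Definitions using (tri<; tri≈; tri>)
open import Relation.Binary.PropositionalEquality using (_≡_; _≢_; refl; sym; trans; cong; cong₂; subst; subst₂)
import Relation.Binary.Reasoning.Setoid as SetoidReasoning
open import Relation.Binary.Structures using (IsEquivalence)
open import Relation.Nullary using (¬_; Dec; yes; no)

if-true : {A : Set} {c : Bool} {x y : A} → c ≡ true → (if c then x else y) ≡ x
if-true refl = refl

if-false : {A : Set} {c : Bool} {x y : A} → c ≡ false → (if c then x else y) ≡ y
if-false refl = refl

∧-true : ∀ {b c} → b ≡ true → c ≡ true → b ∧ c ≡ true
∧-true refl c = c

∧-false₁ : ∀ {b c} → b ≡ false → b ∧ c ≡ false
∧-false₁ refl = refl

∧-false₂ : ∀ {b c} → c ≡ false → b ∧ c ≡ false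
∧-false₂ {true}  c = c
∧-false₂ {false} c = refl

∨-true₁ : ∀ {b c} → b ≡ true → b ∨ c ≡ true
∨-true₁ refl = refl

∨-true₂ : ∀ {b c} → c ≡ true → b ∨ c ≡ true
∨-true₂ {true}  c = refl
∨-true₂ {false} c = c

∨-false : ∀ {b c} → b ≡ false → c ≡ false → b ∨ c ≡ false
∨-false refl c = c

¬T⇒≡false : ∀ {b} → ¬ T b → b ≡ false
¬T⇒≡false {false} _  = refl
¬T⇒≡false {true}  ¬t = ⊥-elim (¬t tt)

≤⇒≤ᵇ≡true : ∀ {m n} → m ≤ n → (m ≤ᵇ n) ≡ true
≤⇒≤ᵇ≡true m≤n = Equivalence.to T-≡ (≤⇒≤ᵇ m≤n)

>⇒≤ᵇ≡false : ∀ {m n} → n < m → (m ≤ᵇ n) ≡ false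
>⇒≤ᵇ≡false {m} {n} n<m = ¬T⇒≡false (<⇒≱ n<m ∘ ≤ᵇ⇒≤ m n)

≡⇒≡ᵇ≡true : ∀ {m n} → m ≡ n → (m ≡ᵇ n) ≡ true
≡⇒≡ᵇ≡true {m} {n} m≡n = Equivalence.to T-≡ (≡⇒≡ᵇ m n m≡n)

≢⇒≡ᵇ≡false : ∀ {m n} → m ≢ n → (m ≡ᵇ n) ≡ false
≢⇒≡ᵇ≡false {m} {n} m≢n = ¬T⇒≡false (m≢n ∘ ≡ᵇ⇒≡ m n)

-- Arcs of a composite

-- Where the arc (p, q) of a composite C ∘[ i ] D lies, D having d + 2 vertices.
-- Vertices i .. i + suc d come from D; vertex q' > i of C becomes q' + d.
data ArcPosition (i d : ℕ) : ℕ → ℕ → Set where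
  before    : ∀ {p q} → p < q → q ≤ i → ArcPosition i d p q
  across    : ∀ {p} q' → p ≤ i → i < q' → p < i ⊎ suc i < q' → ArcPosition i d p (q' + d)
  after     : ∀ p' q' → i < p' → p' < q' → ArcPosition i d (p' + d) (q' + d)
  inside    : ∀ x y → x < y → y ≤ suc d → 0 < x ⊎ y < suc d → ArcPosition i d (i + x) (i + y)
  glued     : ArcPosition i d i (i + suc d)
  crossingˡ : ∀ {p q} → p < i → i < q → q < i + suc d → ArcPosition i d p q
  crossingʳ : ∀ {p q} → i < p → p < i + suc d → i + suc d < q → ArcPosition i d p q

private
  d≤ : ∀ {i d r} → i + suc d ≤ r → d ≤ r
  d≤ {i} {d} {r} le = ≤-trans (m≤n+m d (suc i)) (subst (_≤ r) (+-suc i d) le)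

  <∸ : ∀ {i d r} → i + suc d ≤ r → i < r ∸ d
  <∸ {i} {d} {r} le = +-cancelʳ-≤ d (suc i) (r ∸ d)
    (subst (suc i + d ≤_) (sym (m∸n+n≡m (d≤ {i} le))) (subst (_≤ r) (+-suc i d) le))

  ∸+ : ∀ {i d r} → i + suc d ≤ r → r ∸ d + d ≡ r
  ∸+ {i} le = m∸n+n≡m (d≤ {i} le)

  ∸<suc : ∀ {i d q} → i ≤ q → q < i + suc d → q ∸ i < suc d
  ∸<suc {i} {d} {q} i≤q q< = subst (q ∸ i <_) (m+n∸m≡n i (suc d)) (∸-monoˡ-< q< i≤q)

arcPosition : ∀ i d p q → p < q → ArcPosition i d p q
arcPosition i d p q p<q with q ≤? i | i + suc d ≤? p
... | yes q≤i | _ = before p<q q≤i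
... | no q≰i | yes far = subst₂ (ArcPosition i d) (∸+ far) (∸+ far′)
      (after (p ∸ d) (q ∸ d) (<∸ far) (∸-monoˡ-< p<q (d≤ {i} far)))
  where
  far′ : i + suc d ≤ q
  far′ = ≤-trans far (<⇒≤ p<q)
... | no q≰i | no near with <-cmp p i | i + suc d ≤? q | q ≟ i + suc d
... | tri< p<i _ _ | yes q-far | _ =
      subst (ArcPosition i d p) (∸+ q-far) (across (q ∸ d) (<⇒≤ p<i) (<∸ q-far) (inj₁ p<i))
... | tri< p<i _ _ | no q-near | _ = crossingˡ p<i (≰⇒> q≰i) (≰⇒> q-near)
... | tri≈ _ refl _ | _ | yes refl = glued
... | tri≈ _ refl _ | yes q-far | no q≢ =
      subst (ArcPosition i d i) (∸+ q-far)
        (across (q ∸ d) ≤-refl (<∸ q-far) (inj₂ (<∸ {suc i} {d} {q} (≤∧≢⇒< q-far (q≢ ∘ sym)))))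
... | tri≈ _ refl _ | no q-near | _ =
      subst₂ (ArcPosition i d) (+-identityʳ i) (m+[n∸m]≡n (<⇒≤ i<q))
        (inside 0 (q ∸ i) (m<n⇒0<n∸m i<q) (<⇒≤ q∸i<) (inj₂ q∸i<))
  where
  i<q : i < q
  i<q = ≰⇒> q≰i
  q∸i< : q ∸ i < suc d
  q∸i< = ∸<suc (<⇒≤ i<q) (≰⇒> q-near)
... | tri> _ _ i<p | _ | _ with q ≤? i + suc d
...   | yes q≤ = subst₂ (ArcPosition i d) (m+[n∸m]≡n (<⇒≤ i<p)) (m+[n∸m]≡n (<⇒≤ (<-trans i<p p<q)))
        (inside (p ∸ i) (q ∸ i) (∸-monoˡ-< p<q (<⇒≤ i<p))
          (subst (q ∸ i ≤_) (m+n∸m≡n i (suc d)) (∸-monoˡ-≤ i q≤)) (inj₁ (m<n⇒0<n∸m i<p)))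
...   | no q≰ = crossingʳ i<p (≰⇒> near) (≰⇒> q≰)

module Composite (C D : Config) (i d : ℕ) (size-D : size D ≡ suc d) where

  colourAt : ∀ {p q} → ArcPosition i d p q → Colour
  colourAt (before {p} {q} _ _)  = col C p q
  colourAt (across {p} q' _ _ _) = col C p q'
  colourAt (after p' q' _ _)     = col C p' q'
  colourAt (inside x y _ _ _)    = col D (suc x) (suc y)
  colourAt glued                 = glue (col C i (suc i)) (col D 1 (suc (suc d)))
  colourAt (crossingˡ _ _ _)     = none
  colourAt (crossingʳ _ _ _)     = none

  private
    m : ℕ
    m = size D

    -- Verbatim copies of the tests made by _∘[_]_, so that lemmas about them
    -- apply definitionally to the unfolded composite.
    isGlued fromC fromD : ℕ → ℕ → Bool
    isGlued p q = (p ≡ᵇ i) ∧ (q ≡ᵇ (i + m))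
    fromC p q = ((p ≤ᵇ i) ∨ ((i + m) ≤ᵇ p)) ∧ ((q ≤ᵇ i) ∨ ((i + m) ≤ᵇ q))
    fromD p q = ((i ≤ᵇ p) ∧ (p ≤ᵇ (i + m))) ∧ ((i ≤ᵇ q) ∧ (q ≤ᵇ (i + m)))

    backC : ℕ → ℕ
    backC p = if p ≤ᵇ i then p else p ∸ (m ∸ 1)

    in-C : ∀ p → p ≤ i ⊎ i + m ≤ p → ((p ≤ᵇ i) ∨ (i + m ≤ᵇ p)) ≡ true
    in-C p (inj₁ p≤i) = ∨-true₁ (≤⇒≤ᵇ≡true p≤i)
    in-C p (inj₂ p≥) = ∨-true₂ {b = p ≤ᵇ i} (≤⇒≤ᵇ≡true p≥)

    not-glued : ∀ p q → p ≢ i ⊎ q ≢ i + m → isGlued p q ≡ false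
    not-glued p q (inj₁ p≢i) = ∧-false₁ (≢⇒≡ᵇ≡false p≢i)
    not-glued p q (inj₂ q≢) = ∧-false₂ {b = p ≡ᵇ i} (≢⇒≡ᵇ≡false q≢)

    not-C : ∀ p q → (i < p × p < i + m) ⊎ (i < q × q < i + m) → fromC p q ≡ false
    not-C p q (inj₁ (i<p , p<)) = ∧-false₁ (∨-false (>⇒≤ᵇ≡false i<p) (>⇒≤ᵇ≡false p<))
    not-C p q (inj₂ (i<q , q<)) =
      ∧-false₂ {b = (p ≤ᵇ i) ∨ (i + m ≤ᵇ p)} (∨-false (>⇒≤ᵇ≡false i<q) (>⇒≤ᵇ≡false q<))

    C-branch : ∀ p q → p ≢ i ⊎ q ≢ i + m → p ≤ i ⊎ i + m ≤ p → q ≤ i ⊎ i + m ≤ q →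
               col (C ∘[ i ] D) p q ≡ col C (backC p) (backC q)
    C-branch p q g cp cq = trans (if-false (not-glued p q g)) (if-true (∧-true (in-C p cp) (in-C q cq)))

    D-branch : ∀ p q → p ≢ i ⊎ q ≢ i + m → (i < p × p < i + m) ⊎ (i < q × q < i + m) →
               i ≤ p → p ≤ q → q ≤ i + m → col (C ∘[ i ] D) p q ≡ col D (suc (p ∸ i)) (suc (q ∸ i))
    D-branch p q g c i≤p p≤q q≤ = trans (if-false (not-glued p q g)) (trans (if-false (not-C p q c))
      (if-true (∧-true (∧-true (≤⇒≤ᵇ≡true i≤p) (≤⇒≤ᵇ≡true (≤-trans p≤q q≤)))
                       (∧-true (≤⇒≤ᵇ≡true (≤-trans i≤p p≤q)) (≤⇒≤ᵇ≡true q≤)))))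

    none-branch : ∀ p q → p ≢ i → (i < p × p < i + m) ⊎ (i < q × q < i + m) → p < i ⊎ i + m < q →
                  col (C ∘[ i ] D) p q ≡ none
    none-branch p q p≢i c outside = trans (if-false (not-glued p q (inj₁ p≢i)))
      (trans (if-false (not-C p q c)) (if-false (not-D outside)))
      where
      not-D : p < i ⊎ i + m < q → fromD p q ≡ false
      not-D (inj₁ p<i) = ∧-false₁ (∧-false₁ (>⇒≤ᵇ≡false p<i))
      not-D (inj₂ q>) = ∧-false₂ {b = (i ≤ᵇ p) ∧ (p ≤ᵇ i + m)} (∧-false₂ {b = i ≤ᵇ q} (>⇒≤ᵇ≡false q>))

    top : i + m ≡ suc i + d
    top = trans (cong (i +_) size-D) (+-suc i d)

    im : i + m ≡ i + suc d
    im = cong (i +_) size-D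

    backC-shifted : ∀ {q'} → i < q' → backC (q' + d) ≡ q'
    backC-shifted {q'} i<q' = trans (if-false (>⇒≤ᵇ≡false (≤-trans i<q' (m≤m+n q' d))))
      (trans (cong (q' + d ∸_) (cong (_∸ 1) size-D)) (m+n∸n≡m q' d))

    backC-≤ : ∀ {p} → p ≤ i → backC p ≡ p
    backC-≤ p≤i = if-true (≤⇒≤ᵇ≡true p≤i)

    shifted-beyond : ∀ {r} → i < r → i + m ≤ r + d
    shifted-beyond {r} i<r = subst (_≤ r + d) (sym top) (+-monoˡ-≤ d i<r)

  col-before : ∀ {p q} → p < q → q ≤ i → col (C ∘[ i ] D) p q ≡ col C p q
  col-before {p} {q} p<q q≤i = trans
    (C-branch p q (inj₂ (λ e → <⇒≢ (≤-<-trans q≤i (subst (i <_) (sym top) (s≤s (m≤m+n i d)))) e))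
              (inj₁ p≤i) (inj₁ q≤i))
    (cong₂ (col C) (backC-≤ p≤i) (backC-≤ q≤i))
    where
    p≤i : p ≤ i
    p≤i = ≤-trans (<⇒≤ p<q) q≤i

  col-across : ∀ {p} q' → p ≤ i → i < q' → p < i ⊎ suc i < q' → col (C ∘[ i ] D) p (q' + d) ≡ col C p q'
  col-across {p} q' p≤i i<q' not-base = trans
    (C-branch p (q' + d) (not-base′ not-base) (inj₁ p≤i) (inj₂ (shifted-beyond i<q')))
    (cong₂ (col C) (backC-≤ p≤i) (backC-shifted i<q'))
    where
    not-base′ : p < i ⊎ suc i < q' → p ≢ i ⊎ q' + d ≢ i + m
    not-base′ (inj₁ p<i) = inj₁ (<⇒≢ p<i)
    not-base′ (inj₂ i+1<q') = inj₂ λ e → <⇒≢ i+1<q' (sym (+-cancelʳ-≡ d q' (suc i) (trans e top)))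

  col-after : ∀ p' q' → i < p' → p' < q' → col (C ∘[ i ] D) (p' + d) (q' + d) ≡ col C p' q'
  col-after p' q' i<p' p'<q' = trans
    (C-branch (p' + d) (q' + d) (inj₁ (λ e → <⇒≢ (≤-trans i<p' (m≤m+n p' d)) (sym e)))
              (inj₂ (shifted-beyond i<p')) (inj₂ (shifted-beyond (<-trans i<p' p'<q'))))
    (cong₂ (col C) (backC-shifted i<p') (backC-shifted (<-trans i<p' p'<q')))

  col-inside : ∀ x y → x < y → y ≤ suc d → 0 < x ⊎ y < suc d →
               col (C ∘[ i ] D) (i + x) (i + y) ≡ col D (suc x) (suc y)
  col-inside x y x<y y≤ not-base = trans
    (D-branch (i + x) (i + y) (not-glued′ not-base) (strictly-inside not-base)
              (m≤m+n i x) (+-monoʳ-≤ i (<⇒≤ x<y)) (subst (i + y ≤_) (sym im) (+-monoʳ-≤ i y≤)))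
    (cong₂ (λ a b → col D (suc a) (suc b)) (m+n∸m≡n i x) (m+n∸m≡n i y))
    where
    inside′ : ∀ z → 0 < z → z < suc d → i < i + z × i + z < i + m
    inside′ z 0<z z< = subst (_< i + z) (+-identityʳ i) (+-monoʳ-< i 0<z) , subst (i + z <_) (sym im) (+-monoʳ-< i z<)
    strictly-inside : 0 < x ⊎ y < suc d → (i < i + x × i + x < i + m) ⊎ (i < i + y × i + y < i + m)
    strictly-inside (inj₁ 0<x) = inj₁ (inside′ x 0<x (<-≤-trans x<y y≤))
    strictly-inside (inj₂ y<) = inj₂ (inside′ y (≤-<-trans z≤n x<y) y<)
    not-glued′ : 0 < x ⊎ y < suc d → i + x ≢ i ⊎ i + y ≢ i + m
    not-glued′ (inj₁ 0<x) = inj₁ λ e → <⇒≢ 0<x (sym (+-cancelˡ-≡ i x 0 (trans e (sym (+-identityʳ i)))))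
    not-glued′ (inj₂ y<) = inj₂ λ e → <⇒≢ y< (+-cancelˡ-≡ i y (suc d) (trans e im))

  col-glued : col (C ∘[ i ] D) i (i + suc d) ≡ glue (col C i (suc i)) (col D 1 (suc (suc d)))
  col-glued = trans (if-true (∧-true (≡⇒≡ᵇ≡true {i} refl) (≡⇒≡ᵇ≡true (sym im))))
    (cong (λ s → glue (col C i (suc i)) (col D 1 (suc s))) size-D)

  col-crossingˡ : ∀ {p q} → p < i → i < q → q < i + suc d → col (C ∘[ i ] D) p q ≡ none
  col-crossingˡ {p} {q} p<i i<q q< =
    none-branch p q (<⇒≢ p<i) (inj₂ (i<q , subst (q <_) (sym im) q<)) (inj₁ p<i)

  col-crossingʳ : ∀ {p q} → i < p → p < i + suc d → i + suc d < q → col (C ∘[ i ] D) p q ≡ none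
  col-crossingʳ {p} {q} i<p p< q> =
    none-branch p q (λ e → <⇒≢ i<p (sym e)) (inj₁ (i<p , subst (p <_) (sym im) p<)) (inj₂ (subst (_< q) (sym im) q>))

  col-∘ : ∀ {p q} (pos : ArcPosition i d p q) → col (C ∘[ i ] D) p q ≡ colourAt pos
  col-∘ (before p<q q≤i)              = col-before p<q q≤i
  col-∘ (across q' p≤i i<q' not-base) = col-across q' p≤i i<q' not-base
  col-∘ (after p' q' i<p' p'<q')      = col-after p' q' i<p' p'<q'
  col-∘ (inside x y x<y y≤ not-base)  = col-inside x y x<y y≤ not-base
  col-∘ glued                         = col-glued
  col-∘ (crossingˡ p<i i<q q<)        = col-crossingˡ p<i i<q q<
  col-∘ (crossingʳ i<p p< q>)         = col-crossingʳ i<p p< q>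

-- Equality of configurations and the operad laws of CNCB

IsArc-resp : ∀ {m n p q} → m ≡ n → IsArc m p q → IsArc n p q
IsArc-resp {p = p} {q} = subst (λ n → IsArc n p q)

≐-refl : ∀ {C} → C ≐ C
≐-refl = refl , λ _ _ _ → refl

≐-sym : ∀ {C D} → C ≐ D → D ≐ C
≐-sym (s , f) = sym s , λ i j arc → sym (f i j (IsArc-resp (sym s) arc))

≐-trans : ∀ {C D E} → C ≐ D → D ≐ E → C ≐ E
≐-trans (s , f) (s' , g) = trans s s' , λ i j arc → trans (f i j arc) (g i j (IsArc-resp s arc))

-- _≐_ unfolds to a Σ-type from which Agda cannot recover the two
-- configurations; the record wrapper keeps them inferable.
infix 4 _≃_
record _≃_ (C D : Config) : Set where
  constructor ≃-intro
  field ≃⇒≐ : C ≐ D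
open _≃_ public

≃-isEquivalence : IsEquivalence _≃_
≃-isEquivalence = record
  { refl  = ≃-intro ≐-refl
  ; sym   = λ p → ≃-intro (≐-sym (≃⇒≐ p))
  ; trans = λ p q → ≃-intro (≐-trans (≃⇒≐ p) (≃⇒≐ q))
  }

configSetoid : Setoid 0ℓ 0ℓ
configSetoid = record { isEquivalence = ≃-isEquivalence }

open IsEquivalence ≃-isEquivalence
  using () renaming (refl to ≃-refl; sym to ≃-sym; trans to ≃-trans)

open SetoidReasoning configSetoid

size-∘ : ∀ C D {i} d → size D ≡ suc d → size (C ∘[ i ] D) ≡ size C + d
size-∘ C D d size-D = trans (cong (λ s → size C + s ∸ 1) size-D) (cong (_∸ 1) (+-suc (size C) d))

module _ {C C' D D' : Config} (i d : ℕ) (1≤i : 1 ≤ i) (i≤ : i ≤ size C)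
         (size-D : size D ≡ suc d) (C≃C' : C ≃ C') (D≃D' : D ≃ D') where

  private
    size-D' : size D' ≡ suc d
    size-D' = trans (sym (proj₁ (≃⇒≐ D≃D'))) size-D
    module S  = Composite C D i d size-D
    module S' = Composite C' D' i d size-D'
    arcC : ∀ p q → IsArc (size C) p q → col C p q ≡ col C' p q
    arcC = proj₂ (≃⇒≐ C≃C')
    arcD : ∀ p q → IsArc (size D) p q → col D p q ≡ col D' p q
    arcD = proj₂ (≃⇒≐ D≃D')

  colourAt-cong : ∀ {p q} (pos : ArcPosition i d p q) → IsArc (size C + d) p q → S.colourAt pos ≡ S'.colourAt pos
  colourAt-cong (before {p} {q} p<q q≤i) (1≤p , _ , _) =
    arcC p q (1≤p , p<q , ≤-trans q≤i (≤-trans i≤ (n≤1+n (size C))))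
  colourAt-cong (across {p} q' p≤i i<q' _) (1≤p , _ , q≤) =
    arcC p q' (1≤p , ≤-<-trans p≤i i<q' , +-cancelʳ-≤ d q' (suc (size C)) q≤)
  colourAt-cong (after p' q' i<p' p'<q') (_ , _ , q≤) =
    arcC p' q' (≤-trans 1≤i (<⇒≤ i<p') , p'<q' , +-cancelʳ-≤ d q' (suc (size C)) q≤)
  colourAt-cong (inside x y x<y y≤ _) _ =
    arcD (suc x) (suc y) (s≤s z≤n , s≤s x<y , subst (λ s → suc y ≤ suc s) (sym size-D) (s≤s y≤))
  colourAt-cong glued _ = cong₂ glue (arcC i (suc i) (1≤i , ≤-refl , s≤s i≤))
    (arcD 1 (suc (suc d)) (≤-refl , s≤s (s≤s z≤n) , subst (λ s → suc (suc d) ≤ suc s) (sym size-D) ≤-refl))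
  colourAt-cong (crossingˡ _ _ _) _ = refl
  colourAt-cong (crossingʳ _ _ _) _ = refl

  ∘-cong : C ∘[ i ] D ≃ C' ∘[ i ] D'
  ∘-cong = ≃-intro (cong₂ (λ a b → a + b ∸ 1) (proj₁ (≃⇒≐ C≃C')) (proj₁ (≃⇒≐ D≃D')) , same)
    where
    same : ∀ p q → IsArc (size (C ∘[ i ] D)) p q → col (C ∘[ i ] D) p q ≡ col (C' ∘[ i ] D') p q
    same p q arc@(_ , p<q , _) = let pos = arcPosition i d p q p<q in
      trans (S.col-∘ pos) (trans (colourAt-cong pos (IsArc-resp (size-∘ C D {i} d size-D) arc)) (sym (S'.col-∘ pos)))

data NotRed : Colour → Set where
  blue-nr : NotRed blue
  none-nr : NotRed none

glue-blueʳ : ∀ {c} → NotRed c → glue c blue ≡ c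
glue-blueʳ blue-nr = refl
glue-blueʳ none-nr = refl

glue-blueˡ : ∀ {c} → NotRed c → glue blue c ≡ c
glue-blueˡ blue-nr = refl
glue-blueˡ none-nr = refl

∘-identityʳ : ∀ C i → 1 ≤ i → i ≤ size C → NotRed (col C i (suc i)) → C ∘[ i ] unitC ≃ C
∘-identityʳ C i 1≤i i≤ edge = ≃-intro (trans (size-∘ C unitC {i} 0 refl) (+-identityʳ (size C)) , λ p q arc@(_ , p<q , _) →
  let pos = arcPosition i 0 p q p<q in trans (S.col-∘ pos) (same pos (IsArc-resp (size-∘ C unitC {i} 0 refl) arc)))
  where
  module S = Composite C unitC i 0 refl
  no-vertex-between : ∀ {r} → i < r → r < i + 1 → ⊥
  no-vertex-between {r} i<r r< = <⇒≱ i<r (≤-pred (subst (r <_) (+-comm i 1) r<))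
  same : ∀ {p q} (pos : ArcPosition i 0 p q) → IsArc (size C + 0) p q → S.colourAt pos ≡ col C p q
  same (before _ _) _ = refl
  same (across {p} q' _ _ _) _ = cong (col C p) (sym (+-identityʳ q'))
  same (after p' q' _ _) _ = sym (cong₂ (col C) (+-identityʳ p') (+-identityʳ q'))
  same (inside 0 1 _ _ (inj₁ ()))
  same (inside 0 1 _ _ (inj₂ (s≤s ())))
  same (inside (suc x) _ (s≤s x<y) (s≤s y≤0) _) = ⊥-elim (<⇒≱ (<-≤-trans x<y y≤0) z≤n)
  same glued _ = trans (glue-blueʳ edge) (cong (col C i) (+-comm 1 i))
  same (crossingˡ _ i<q q<) _ = ⊥-elim (no-vertex-between i<q q<)
  same (crossingʳ i<p p< _) _ = ⊥-elim (no-vertex-between i<p p<)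

∘-identityˡ : ∀ E e → size E ≡ suc e → NotRed (col E 1 (suc (suc e))) → unitC ∘[ 1 ] E ≃ E
∘-identityˡ E e size-E base = ≃-intro (refl , λ p q arc@(_ , p<q , _) →
  let pos = arcPosition 1 e p q p<q in trans (S.col-∘ pos) (same pos (IsArc-resp (size-∘ unitC E {1} e size-E) arc)))
  where
  module S = Composite unitC E 1 e size-E
  same : ∀ {p q} (pos : ArcPosition 1 e p q) → IsArc (1 + e) p q → S.colourAt pos ≡ col E p q
  same (before p<q q≤1) (1≤p , _ , _) = ⊥-elim (<⇒≱ (≤-<-trans 1≤p p<q) q≤1)
  same (across q' _ _ (inj₁ p<1)) (1≤p , _ , _) = ⊥-elim (<⇒≱ p<1 1≤p)
  same (across q' _ _ (inj₂ 2<q')) (_ , _ , q≤) = ⊥-elim (<⇒≱ 2<q' (+-cancelʳ-≤ e q' 2 q≤))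
  same (after p' q' 1<p' p'<q') (_ , _ , q≤) = ⊥-elim (<⇒≱ (≤-<-trans 1<p' p'<q') (+-cancelʳ-≤ e q' 2 q≤))
  same (inside _ _ _ _ _) _ = refl
  same glued _ = glue-blueˡ base
  same (crossingˡ p<1 _ _) (1≤p , _ , _) = ⊥-elim (<⇒≱ p<1 1≤p)
  same (crossingʳ _ _ q>) (_ , _ , q≤) = ⊥-elim (<⇒≱ q> q≤)

∘-congˡ : ∀ {C C'} i D d → 1 ≤ i → i ≤ size C → size D ≡ suc d → C ≃ C' → C ∘[ i ] D ≃ C' ∘[ i ] D
∘-congˡ {C} {C'} i D d 1≤i i≤ size-D C≃C' = ∘-cong {C} {C'} {D} {D} i d 1≤i i≤ size-D C≃C' ≃-refl

∘-congʳ : ∀ C i {D D'} d → 1 ≤ i → i ≤ size C → size D ≡ suc d → D ≃ D' → C ∘[ i ] D ≃ C ∘[ i ] D'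
∘-congʳ C i {D} {D'} d 1≤i i≤ size-D D≃D' = ∘-cong {C} {C} {D} {D'} i d 1≤i i≤ size-D ≃-refl D≃D'

module Parallel (C D E : Config) (i j d e : ℕ) (size-D : size D ≡ suc d) (size-E : size E ≡ suc e)
                (i<j : i < j) where
  J : ℕ
  J = j + d
  X W Y Z : Config
  X = C ∘[ i ] D
  W = C ∘[ j ] E
  Y = X ∘[ J ] E
  Z = W ∘[ i ] D
  module SX = Composite C D i d size-D
  module SY = Composite X E J e size-E
  module SW = Composite C E j e size-E
  module SZ = Composite W D i d size-D

  D-before-J : i + suc d ≤ J
  D-before-J = subst (_≤ J) (sym (+-suc i d)) (+-monoˡ-≤ d i<j)

  swap-d : ∀ r s → r + s + d ≡ r + d + s
  swap-d r s = xy∙z≈xz∙y r s d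

  col-across : ∀ {p} q' → p ≤ i → i < q' → p < i ⊎ suc i < q' → ArcPosition j e p q' →
               col Y p (q' + d) ≡ col Z p (q' + d)
  col-across {p} q' p≤i i<q' alt (before _ q'≤j) =
    trans (SY.col-before (≤-<-trans p≤i (<-≤-trans i<q' (m≤m+n q' d))) (+-monoˡ-≤ d q'≤j))
      (trans (SX.col-across q' p≤i i<q' alt)
        (sym (trans (SZ.col-across q' p≤i i<q' alt) (SW.col-before (≤-<-trans p≤i i<q') q'≤j))))
  col-across {p} .(q'' + e) p≤i i<q' alt (across q'' p≤j j<q'' alt′) =
    trans (cong (col Y p) (swap-d q'' e))
      (trans (SY.col-across (q'' + d) (≤-trans (<⇒≤ p<j) (m≤m+n j d)) (+-monoˡ-< d j<q'') (inj₁ (<-≤-trans p<j (m≤m+n j d))))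
      (trans (SX.col-across q'' p≤i (<-trans i<j j<q'') (inj₂ (≤-<-trans i<j j<q'')))
      (sym (trans (SZ.col-across (q'' + e) p≤i i<q' alt) (SW.col-across q'' p≤j j<q'' alt′)))))
    where
    p<j : p < j
    p<j = ≤-<-trans p≤i i<j
  col-across q' p≤i _ _ (after p'' _ j<p'' _) = ⊥-elim (<⇒≱ (≤-trans j<p'' (m≤m+n p'' e)) (<⇒≤ (≤-<-trans p≤i i<j)))
  col-across q' p≤i _ _ (inside x _ _ _ _) = ⊥-elim (<⇒≱ (≤-<-trans p≤i i<j) (m≤m+n j x))
  col-across q' p≤i _ _ glued = ⊥-elim (<⇒≱ (≤-<-trans p≤i i<j) ≤-refl)
  col-across q' p≤i i<q' alt (crossingˡ p<j j<q' q'<) =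
    trans (SY.col-crossingˡ (<-≤-trans p<j (m≤m+n j d)) (+-monoˡ-< d j<q')
                            (subst (q' + d <_) (swap-d j (suc e)) (+-monoˡ-< d q'<)))
      (sym (trans (SZ.col-across q' p≤i i<q' alt) (SW.col-crossingˡ p<j j<q' q'<)))
  col-across q' p≤i _ _ (crossingʳ j<p _ _) = ⊥-elim (<⇒≱ j<p (<⇒≤ (≤-<-trans p≤i i<j)))

  col-after : ∀ p' q' → i < p' → p' < q' → ArcPosition j e p' q' → col Y (p' + d) (q' + d) ≡ col Z (p' + d) (q' + d)
  col-after p' q' i<p' p'<q' (before _ q'≤j) =
    trans (SY.col-before (+-monoˡ-< d p'<q') (+-monoˡ-≤ d q'≤j))
      (trans (SX.col-after p' q' i<p' p'<q') (sym (trans (SZ.col-after p' q' i<p' p'<q') (SW.col-before p'<q' q'≤j))))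
  col-after p' .(q'' + e) i<p' p'<q' (across q'' p'≤j j<q'' alt) =
    trans (cong (col Y (p' + d)) (swap-d q'' e))
      (trans (SY.col-across (q'' + d) (+-monoˡ-≤ d p'≤j) (+-monoˡ-< d j<q'') (shift-alt alt))
      (trans (SX.col-after p' q'' i<p' (≤-<-trans p'≤j j<q''))
      (sym (trans (SZ.col-after p' (q'' + e) i<p' p'<q') (SW.col-across q'' p'≤j j<q'' alt)))))
    where
    shift-alt : p' < j ⊎ suc j < q'' → p' + d < j + d ⊎ suc (j + d) < q'' + d
    shift-alt (inj₁ lt) = inj₁ (+-monoˡ-< d lt)
    shift-alt (inj₂ lt) = inj₂ (+-monoˡ-< d lt)
  col-after .(p'' + e) .(q'' + e) i<p' p'<q' (after p'' q'' j<p'' p''<q'') =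
    trans (cong₂ (col Y) (swap-d p'' e) (swap-d q'' e))
      (trans (SY.col-after (p'' + d) (q'' + d) (+-monoˡ-< d j<p'') (+-monoˡ-< d p''<q''))
      (trans (SX.col-after p'' q'' (<-trans i<j j<p'') p''<q'')
      (sym (trans (SZ.col-after (p'' + e) (q'' + e) i<p' p'<q') (SW.col-after p'' q'' j<p'' p''<q'')))))
  col-after .(j + x) .(j + y) i<p' p'<q' (inside x y x<y y≤ alt) =
    trans (cong₂ (col Y) (swap-d j x) (swap-d j y))
      (trans (SY.col-inside x y x<y y≤ alt)
      (sym (trans (SZ.col-after (j + x) (j + y) i<p' p'<q') (SW.col-inside x y x<y y≤ alt))))
  col-after .j .(j + suc e) i<p' p'<q' glued =
    trans (cong (col Y (j + d)) (swap-d j (suc e)))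
      (trans SY.col-glued
      (trans (cong (λ c → glue c (col E 1 (suc (suc e)))) (SX.col-after j (suc j) i<j ≤-refl))
      (sym (trans (SZ.col-after j (j + suc e) i<p' p'<q') SW.col-glued))))
  col-after p' q' i<p' p'<q' (crossingˡ p'<j j<q' q'<) =
    trans (SY.col-crossingˡ (+-monoˡ-< d p'<j) (+-monoˡ-< d j<q') (subst (q' + d <_) (swap-d j (suc e)) (+-monoˡ-< d q'<)))
      (sym (trans (SZ.col-after p' q' i<p' p'<q') (SW.col-crossingˡ p'<j j<q' q'<)))
  col-after p' q' i<p' p'<q' (crossingʳ j<p' p'< q'>) =
    trans (SY.col-crossingʳ (+-monoˡ-< d j<p') (subst (p' + d <_) (swap-d j (suc e)) (+-monoˡ-< d p'<))
                            (subst (_< q' + d) (swap-d j (suc e)) (+-monoˡ-< d q'>)))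
      (sym (trans (SZ.col-after p' q' i<p' p'<q') (SW.col-crossingʳ j<p' p'< q'>)))

  col-crossingʳ : ∀ {p q} → i < p → p < i + suc d → i + suc d < q → ArcPosition J e p q → col Y p q ≡ none
  col-crossingʳ i<p p< q> (before p<q q≤J) = trans (SY.col-before p<q q≤J) (SX.col-crossingʳ i<p p< q>)
  col-crossingʳ {p} i<p p< q> (across q'' _ J<q'' _) =
    trans (SY.col-across q'' (<⇒≤ p<J) J<q'' (inj₁ p<J)) (SX.col-crossingʳ i<p p< (<-≤-trans (s≤s D-before-J) J<q''))
    where
    p<J : p < J
    p<J = <-≤-trans p< D-before-J
  col-crossingʳ i<p p< q> (after p'' _ J<p'' _) = ⊥-elim (<⇒≱ J<p'' (≤-trans (m≤m+n p'' e) (<⇒≤ (<-≤-trans p< D-before-J))))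
  col-crossingʳ i<p p< q> (inside x _ _ _ _) = ⊥-elim (<⇒≱ (<-≤-trans p< D-before-J) (m≤m+n J x))
  col-crossingʳ i<p p< q> glued = ⊥-elim (<⇒≱ (<-≤-trans p< D-before-J) ≤-refl)
  col-crossingʳ i<p p< q> (crossingˡ p<J J<q q<) = SY.col-crossingˡ p<J J<q q<
  col-crossingʳ i<p p< q> (crossingʳ J<p _ _) = ⊥-elim (<⇒≱ J<p (<⇒≤ (<-≤-trans p< D-before-J)))

  col-parallel : ∀ p q → p < q → col Y p q ≡ col Z p q
  col-parallel p q p<q with arcPosition i d p q p<q
  ... | before _ q≤i =
    trans (SY.col-before p<q (≤-trans q≤i (≤-trans (<⇒≤ i<j) (m≤m+n j d))))
      (trans (SX.col-before p<q q≤i) (sym (trans (SZ.col-before p<q q≤i) (SW.col-before p<q (≤-trans q≤i (<⇒≤ i<j))))))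
  ... | across q' p≤i i<q' alt = col-across q' p≤i i<q' alt (arcPosition j e p q' (≤-<-trans p≤i i<q'))
  ... | after p' q' i<p' p'<q' = col-after p' q' i<p' p'<q' (arcPosition j e p' q' p'<q')
  ... | inside x y x<y y≤ alt =
    trans (SY.col-before (+-monoʳ-< i x<y) (≤-trans (+-monoʳ-≤ i y≤) D-before-J))
      (trans (SX.col-inside x y x<y y≤ alt) (sym (SZ.col-inside x y x<y y≤ alt)))
  ... | glued =
    trans (SY.col-before (subst (i <_) (sym (+-suc i d)) (s≤s (m≤m+n i d))) D-before-J)
      (trans SX.col-glued (sym (trans SZ.col-glued (cong (λ c → glue c (col D 1 (suc (suc d)))) (SW.col-before ≤-refl i<j)))))
  ... | crossingˡ p<i i<q q< =
    trans (SY.col-before p<q (≤-trans (<⇒≤ q<) D-before-J))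
      (trans (SX.col-crossingˡ p<i i<q q<) (sym (SZ.col-crossingˡ p<i i<q q<)))
  ... | crossingʳ i<p p< q> = trans (col-crossingʳ i<p p< q> (arcPosition J e p q p<q)) (sym (SZ.col-crossingʳ i<p p< q>))

∘-parallel : ∀ C D E i j d e → size D ≡ suc d → size E ≡ suc e → i < j →
             (C ∘[ i ] D) ∘[ j + d ] E ≃ (C ∘[ j ] E) ∘[ i ] D
∘-parallel C D E i j d e size-D size-E i<j = ≃-intro
  ( trans (size-∘ (C ∘[ i ] D) E {j + d} e size-E) (trans (cong (_+ e) (size-∘ C D {i} d size-D))
      (trans (xy∙z≈xz∙y (size C) d e)
        (sym (trans (size-∘ (C ∘[ j ] E) D {i} d size-D) (cong (_+ d) (size-∘ C E {j} e size-E))))))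
  , λ p q (_ , p<q , _) → Parallel.col-parallel C D E i j d e size-D size-E i<j p q p<q)

module Sequential (C D E : Config) (i j' d e : ℕ) (size-D : size D ≡ suc d) (size-E : size E ≡ suc e)
                  (1≤d : 1 ≤ d) (j'≤d : j' ≤ d) where
  I : ℕ
  I = i + j'
  X W Y Z : Config
  X = C ∘[ i ] D
  W = D ∘[ suc j' ] E
  Y = X ∘[ I ] E
  Z = C ∘[ i ] W
  size-W : size W ≡ suc (d + e)
  size-W = trans (size-∘ D E {suc j'} e size-E) (cong (_+ e) size-D)
  module SX = Composite C D i d size-D
  module SY = Composite X E I e size-E
  module SW = Composite D E (suc j') e size-E
  module SZ = Composite C W i (d + e) size-W

  i≤I : i ≤ I
  i≤I = m≤m+n i j'
  I<i+suc-d : I < i + suc d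
  I<i+suc-d = +-monoʳ-< i (s≤s j'≤d)
  j'+suc-e≤ : j' + suc e ≤ suc (d + e)
  j'+suc-e≤ = subst (j' + suc e ≤_) (+-suc d e) (+-monoˡ-≤ (suc e) j'≤d)
  I+suc-e≤ : I + suc e ≤ i + suc (d + e)
  I+suc-e≤ = subst (_≤ i + suc (d + e)) (sym (+-assoc i j' (suc e))) (+-monoʳ-≤ i j'+suc-e≤)
  suc-e<suc-d+e : suc e < suc (d + e)
  suc-e<suc-d+e = s≤s (+-monoˡ-≤ e 1≤d)
  i+suc-d≤ : ∀ {q'} → i < q' → i + suc d ≤ q' + d
  i+suc-d≤ {q'} i<q' = subst (_≤ q' + d) (sym (+-suc i d)) (+-monoˡ-≤ d i<q')
  not-after-I : ∀ {q'} → i < q' → q' + d ≤ I → ⊥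
  not-after-I i<q' le = <⇒≱ I<i+suc-d (≤-trans (i+suc-d≤ i<q') le)
  cancel-i-≤ : ∀ {x y} → i + x ≤ i + y → x ≤ y
  cancel-i-≤ {x} {y} = +-cancelˡ-≤ i x y
  cancel-i-< : ∀ {x y} → i + x < i + y → x < y
  cancel-i-< {x} {y} = +-cancelˡ-< i x y
  assoc-i : ∀ x → i + x + e ≡ i + (x + e)
  assoc-i x = +-assoc i x e
  cancel-i-0< : ∀ {y} → i < i + y → 0 < y
  cancel-i-0< {y} lt = cancel-i-< (subst (_< i + y) (sym (+-identityʳ i)) lt)
  assoc-end : i + suc d + e ≡ i + suc (d + e)
  assoc-end = assoc-i (suc d)

  col-before : ∀ {p q} → p < q → q ≤ I → ArcPosition i d p q → col X p q ≡ col Z p q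
  col-before p<q q≤I (before _ q≤i) = trans (SX.col-before p<q q≤i) (sym (SZ.col-before p<q q≤i))
  col-before p<q q≤I (across q' _ i<q' _) = ⊥-elim (not-after-I i<q' q≤I)
  col-before p<q q≤I (after p' q' i<p' p'<q') = ⊥-elim (not-after-I (<-trans i<p' p'<q') q≤I)
  col-before p<q q≤I (inside x y x<y y≤ alt) = trans (SX.col-inside x y x<y y≤ alt)
    (sym (trans (SZ.col-inside x y x<y (≤-trans y≤j' (≤-trans j'≤d (≤-trans (n≤1+n d) (s≤s (m≤m+n d e)))))
                  (inj₂ (s≤s (≤-trans y≤j' (≤-trans j'≤d (m≤m+n d e))))))
                (SW.col-before (s≤s x<y) (s≤s y≤j'))))
    where
    y≤j' : y ≤ j'
    y≤j' = cancel-i-≤ q≤I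
  col-before p<q q≤I glued = ⊥-elim (<⇒≱ I<i+suc-d q≤I)
  col-before p<q q≤I (crossingˡ p<i i<q q<) = trans (SX.col-crossingˡ p<i i<q q<)
    (sym (SZ.col-crossingˡ p<i i<q (<-≤-trans q< (+-monoʳ-≤ i (s≤s (m≤m+n d e))))))
  col-before p<q q≤I (crossingʳ i<p p< q>) = ⊥-elim (<⇒≱ (<-trans I<i+suc-d q>) (≤-trans q≤I ≤-refl))

  col-across : ∀ {p q'} → p ≤ I → I < q' → (p < I ⊎ suc I < q') → ArcPosition i d p q' → col X p q' ≡ col Z p (q' + e)
  col-across p≤I I<q' altY (before _ q'≤i) = ⊥-elim (<⇒≱ I<q' (≤-trans q'≤i i≤I))
  col-across {p} p≤I I<q' altY (across q'' p≤i i<q'' altX) = trans (SX.col-across q'' p≤i i<q'' altX)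
    (sym (trans (cong (col Z p) (+-assoc q'' d e)) (SZ.col-across q'' p≤i i<q'' altX)))
  col-across p≤I I<q' altY (after p'' q'' i<p'' _) = ⊥-elim (not-after-I i<p'' p≤I)
  col-across p≤I I<q' altY (inside x y x<y y≤ altX) = trans (SX.col-inside x y x<y y≤ altX)
    (sym (trans (cong (col Z (i + x)) (assoc-i y))
         (trans (SZ.col-inside x (y + e) (<-≤-trans x<y (m≤m+n y e)) (+-monoˡ-≤ e y≤) (altZ altX))
                (SW.col-across (suc y) (s≤s (cancel-i-≤ p≤I)) (s≤s (cancel-i-< I<q')) (altW altY)))))
    where
    altZ : 0 < x ⊎ y < suc d → 0 < x ⊎ y + e < suc (d + e)
    altZ (inj₁ z) = inj₁ z
    altZ (inj₂ z) = inj₂ (+-monoˡ-< e z)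
    altW : i + x < I ⊎ suc I < i + y → suc x < suc j' ⊎ suc (suc j') < suc y
    altW (inj₁ z) = inj₁ (s≤s (cancel-i-< z))
    altW (inj₂ z) = inj₂ (s≤s (cancel-i-< (subst (_< i + y) (sym (+-suc i j')) z)))
  col-across p≤I I<q' altY glued = trans SX.col-glued
    (sym (trans (cong (col Z i) assoc-end)
         (trans SZ.col-glued (cong (glue (col C i (suc i)))
           (SW.col-across {1} (suc (suc d)) (s≤s z≤n) (s≤s (s≤s j'≤d)) (altW altY))))))
    where
    altW : i < I ⊎ suc I < i + suc d → 1 < suc j' ⊎ suc (suc j') < suc (suc d)
    altW (inj₁ z) = inj₁ (s≤s (cancel-i-0< z))
    altW (inj₂ z) = inj₂ (s≤s (cancel-i-< (subst (_< i + suc d) (sym (+-suc i j')) z)))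
  col-across {p} {q'} p≤I I<q' altY (crossingˡ p<i i<q q<) = trans (SX.col-crossingˡ p<i i<q q<)
    (sym (SZ.col-crossingˡ p<i (≤-trans i<q (m≤m+n q' e)) (subst (q' + e <_) assoc-end (+-monoˡ-< e q<))))
  col-across {p} {q'} p≤I I<q' altY (crossingʳ i<p p< q>) = trans (SX.col-crossingʳ i<p p< q>)
    (sym (SZ.col-crossingʳ i<p (<-≤-trans p< (+-monoʳ-≤ i (s≤s (m≤m+n d e)))) (subst (_< q' + e) assoc-end (+-monoˡ-< e q>))))

  col-after : ∀ {p' q'} → I < p' → p' < q' → ArcPosition i d p' q' → col X p' q' ≡ col Z (p' + e) (q' + e)
  col-after I<p' p'<q' (before _ q'≤i) = ⊥-elim (<⇒≱ I<p' (≤-trans (≤-trans (<⇒≤ p'<q') q'≤i) i≤I))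
  col-after I<p' _ (across q' p≤i _ _) = ⊥-elim (<⇒≱ I<p' (≤-trans p≤i i≤I))
  col-after I<p' _ (after p'' q'' i<p'' p''<q'') = trans (SX.col-after p'' q'' i<p'' p''<q'')
    (sym (trans (cong₂ (col Z) (+-assoc p'' d e) (+-assoc q'' d e)) (SZ.col-after p'' q'' i<p'' p''<q'')))
  col-after I<p' _ (inside x y x<y y≤ altX) = trans (SX.col-inside x y x<y y≤ altX)
    (sym (trans (cong₂ (col Z) (assoc-i x) (assoc-i y))
         (trans (SZ.col-inside (x + e) (y + e) (+-monoˡ-< e x<y) (+-monoˡ-≤ e y≤)
                  (inj₁ (≤-trans (s≤s z≤n) (≤-trans (cancel-i-< I<p') (m≤m+n x e)))))
                (SW.col-after (suc x) (suc y) (s≤s (cancel-i-< I<p')) (s≤s x<y)))))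
  col-after I<p' _ glued = ⊥-elim (<⇒≱ I<p' i≤I)
  col-after I<p' _ (crossingˡ p<i _ _) = ⊥-elim (<⇒≱ I<p' (≤-trans (<⇒≤ p<i) i≤I))
  col-after {p'} {q'} I<p' _ (crossingʳ i<p p< q>) = trans (SX.col-crossingʳ i<p p< q>)
    (sym (SZ.col-crossingʳ (≤-trans i<p (m≤m+n p' e)) (subst (p' + e <_) assoc-end (+-monoˡ-< e p<))
                           (subst (_< q' + e) assoc-end (+-monoˡ-< e q>))))

  not-base-W : ∀ k x y → y ≤ suc e → 0 < k + x ⊎ k + y < suc (d + e)
  not-base-W zero x y y≤ = inj₂ (≤-<-trans y≤ suc-e<suc-d+e)
  not-base-W (suc k) x y y≤ = inj₁ (s≤s z≤n)
  not-base-W′ : ∀ k → 0 < k ⊎ k + suc e < suc (d + e)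
  not-base-W′ zero = inj₂ suc-e<suc-d+e
  not-base-W′ (suc k) = inj₁ (s≤s z≤n)
  not-base-D : ∀ k → 0 < k ⊎ suc k < suc d
  not-base-D zero = inj₂ (s≤s 1≤d)
  not-base-D (suc k) = inj₁ (s≤s z≤n)

  Z-crossing-Eˡ : ∀ {P Q} x y → P ≡ i + x → Q ≡ i + y → P < I → I < Q → Q < I + suc e → col Z P Q ≡ none
  Z-crossing-Eˡ x y refl refl P<I I<Q Q< =
    trans (SZ.col-inside x y (cancel-i-< (<-trans P<I I<Q)) (<⇒≤ y<) (inj₂ y<))
          (SW.col-crossingˡ (s≤s (cancel-i-< P<I)) (s≤s (cancel-i-< I<Q)) (s≤s (cancel-i-< (subst (i + y <_) (+-assoc i j' (suc e)) Q<))))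
    where
    y< : y < suc (d + e)
    y< = cancel-i-< (<-≤-trans Q< I+suc-e≤)

  Z-crossing-Eʳ : ∀ {P Q} x y → P ≡ i + x → Q ≡ i + y → I < P → P < I + suc e → I + suc e < Q → Q ≤ i + suc (d + e) →
                  col Z P Q ≡ none
  Z-crossing-Eʳ x y refl refl I<P P< Q> Q≤ =
    trans (SZ.col-inside x y (cancel-i-< (<-trans P< Q>)) (cancel-i-≤ Q≤) (inj₁ (≤-trans (s≤s z≤n) (cancel-i-< I<P))))
          (SW.col-crossingʳ (s≤s (cancel-i-< I<P)) (s≤s (cancel-i-< (subst (i + x <_) (+-assoc i j' (suc e)) P<)))
                  (s≤s (cancel-i-< (subst (_< i + y) (+-assoc i j' (suc e)) Q>))))

  col-sequential : ∀ p q → p < q → col Y p q ≡ col Z p q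
  col-sequential p q p<q with arcPosition I e p q p<q
  ... | before _ q≤I = trans (SY.col-before p<q q≤I) (col-before p<q q≤I (arcPosition i d p q p<q))
  ... | across q' p≤I I<q' alt =
    trans (SY.col-across q' p≤I I<q' alt) (col-across p≤I I<q' alt (arcPosition i d p q' (≤-<-trans p≤I I<q')))
  ... | after p' q' I<p' p'<q' = trans (SY.col-after p' q' I<p' p'<q') (col-after I<p' p'<q' (arcPosition i d p' q' p'<q'))
  ... | inside x y x<y y≤ alt = trans (SY.col-inside x y x<y y≤ alt)
    (sym (trans (cong₂ (col Z) (+-assoc i j' x) (+-assoc i j' y))
         (trans (SZ.col-inside (j' + x) (j' + y) (+-monoʳ-< j' x<y) (≤-trans (+-monoʳ-≤ j' y≤) j'+suc-e≤) (not-base-W j' x y y≤))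
                (SW.col-inside x y x<y y≤ alt))))
  ... | glued = trans SY.col-glued
    (trans (cong (λ c → glue c (col E 1 (suc (suc e))))
              (trans (cong (col X I) (sym (+-suc i j'))) (SX.col-inside j' (suc j') ≤-refl (s≤s j'≤d) (not-base-D j'))))
    (sym (trans (cong (col Z I) (+-assoc i j' (suc e)))
         (trans (SZ.col-inside j' (j' + suc e) (subst (j' <_) (sym (+-suc j' e)) (s≤s (m≤m+n j' e))) j'+suc-e≤ (not-base-W′ j'))
                SW.col-glued))))
  ... | crossingˡ p<I I<q q< = trans (SY.col-crossingˡ p<I I<q q<) (sym (Z-none (p <? i)))
    where
    Z-none : Dec (p < i) → col Z p q ≡ none
    Z-none (yes p<i) = SZ.col-crossingˡ p<i (≤-<-trans i≤I I<q) (<-≤-trans q< I+suc-e≤)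
    Z-none (no p≮i) = Z-crossing-Eˡ (p ∸ i) (q ∸ i) (sym (m+[n∸m]≡n (≮⇒≥ p≮i)))
                        (sym (m+[n∸m]≡n (≤-trans (≮⇒≥ p≮i) (<⇒≤ p<q)))) p<I I<q q<
  ... | crossingʳ I<p p< q> = trans (SY.col-crossingʳ I<p p< q>) (sym (Z-none (q ≤? i + suc (d + e))))
    where
    Z-none : Dec (q ≤ i + suc (d + e)) → col Z p q ≡ none
    Z-none (yes q≤) = Z-crossing-Eʳ (p ∸ i) (q ∸ i) (sym (m+[n∸m]≡n (≤-trans i≤I (<⇒≤ I<p))))
                        (sym (m+[n∸m]≡n (≤-trans i≤I (<⇒≤ (<-trans I<p p<q))))) I<p p< q> q≤
    Z-none (no q≰) = SZ.col-crossingʳ (≤-<-trans i≤I I<p) (<-≤-trans p< I+suc-e≤) (≰⇒> q≰)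

-- The hypothesis 1 ≤ d excludes a D of size 1, whose only edge is its base: the
-- glued arc would then be coloured by glue twice, and glue is not associative.
∘-sequential : ∀ C D E i j' d e → size D ≡ suc d → size E ≡ suc e → 1 ≤ d → j' ≤ d →
               (C ∘[ i ] D) ∘[ i + j' ] E ≃ C ∘[ i ] (D ∘[ suc j' ] E)
∘-sequential C D E i j' d e size-D size-E 1≤d j'≤d = ≃-intro
  ( trans (size-∘ (C ∘[ i ] D) E {i + j'} e size-E) (trans (cong (_+ e) (size-∘ C D {i} d size-D))
      (trans (+-assoc (size C) d e) (sym (size-∘ C (D ∘[ suc j' ] E) {i} (d + e) S.size-W))))
  , λ p q (_ , p<q , _) → S.col-sequential p q p<q)
  where module S = Sequential C D E i j' d e size-D size-E 1≤d j'≤d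

-- π is an operad morphism

nodes : Tree → ℕ
nodes leaf         = 0
nodes (node _ l r) = suc (nodes l + nodes r)

arity≡suc-nodes : ∀ t → arity t ≡ suc (nodes t)
arity≡suc-nodes leaf         = refl
arity≡suc-nodes (node _ l r) =
  trans (cong₂ _+_ (arity≡suc-nodes l) (arity≡suc-nodes r)) (cong suc (+-suc (nodes l) (nodes r)))

nodeConfig : Gen₂ → Config → ℕ → Config → Config
nodeConfig g A x B = (πgen g ∘[ 1 ] A) ∘[ suc (suc x) ] B

π-node : ∀ g l r → π (node g l r) ≡ nodeConfig g (π l) (nodes l) (π r)
π-node g l r = cong (λ n → (πgen g ∘[ 1 ] π l) ∘[ suc n ] π r) (arity≡suc-nodes l)

size-πgen : ∀ g → size (πgen g) ≡ 2
size-πgen α = refl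
size-πgen β = refl

1≤size-πgen : ∀ g → 1 ≤ size (πgen g)
1≤size-πgen g = subst (1 ≤_) (sym (size-πgen g)) (s≤s z≤n)

size-πgen∘ : ∀ g A x → size A ≡ suc x → size (πgen g ∘[ 1 ] A) ≡ suc (suc x)
size-πgen∘ g A x size-A = trans (size-∘ (πgen g) A {1} x size-A) (cong (_+ x) (size-πgen g))

size-nodeConfig : ∀ g A x B y → size A ≡ suc x → size B ≡ suc y → size (nodeConfig g A x B) ≡ suc (suc (x + y))
size-nodeConfig g A x B y size-A size-B =
  trans (size-∘ (πgen g ∘[ 1 ] A) B {suc (suc x)} y size-B) (cong (_+ y) (size-πgen∘ g A x size-A))

nodeConfig-congˡ : ∀ g {A A'} x B y → size A ≡ suc x → size B ≡ suc y → A ≃ A' →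
                   nodeConfig g A x B ≃ nodeConfig g A' x B
nodeConfig-congˡ g {A} x B y size-A size-B A≃A' =
  ∘-congˡ (suc (suc x)) B y (s≤s z≤n) (≤-reflexive (sym (size-πgen∘ g A x size-A))) size-B
    (∘-congʳ (πgen g) 1 x ≤-refl (1≤size-πgen g) size-A A≃A')

size-π : ∀ t → size (π t) ≡ suc (nodes t)
size-π leaf         = refl
size-π (node g l r) =
  trans (cong size (π-node g l r)) (size-nodeConfig g (π l) (nodes l) (π r) (nodes r) (size-π l) (size-π r))

edge₁-notRed : ∀ g → NotRed (col (πgen g) 1 2)
edge₁-notRed α = none-nr
edge₁-notRed β = blue-nr

edge₂-notRed : ∀ g → NotRed (col (πgen g) 2 3)
edge₂-notRed α = blue-nr
edge₂-notRed β = blue-nr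

baseColour : Tree → Colour
baseColour leaf         = blue
baseColour (node α _ _) = blue
baseColour (node β _ _) = none

baseColour-notRed : ∀ t → NotRed (baseColour t)
baseColour-notRed leaf         = blue-nr
baseColour-notRed (node α _ _) = blue-nr
baseColour-notRed (node β _ _) = none-nr

module NodeConfig (g : Gen₂) (A : Config) (x : ℕ) (B : Config) (y : ℕ)
                  (size-A : size A ≡ suc x) (size-B : size B ≡ suc y) where
  private
    K : ℕ
    K = suc (suc x)
    module SI = Composite (πgen g) A 1 x size-A
    module SO = Composite (πgen g ∘[ 1 ] A) B K y size-B

  col-base : col (nodeConfig g A x B) 1 (suc K + y) ≡ col (πgen g) 1 3
  col-base = trans (SO.col-across (suc K) (s≤s z≤n) ≤-refl (inj₁ (s≤s (s≤s z≤n))))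
                   (SI.col-across {1} 3 ≤-refl (s≤s (s≤s z≤n)) (inj₂ ≤-refl))

  col-1-into-B : ∀ {q} → K < q → q < K + suc y → col (nodeConfig g A x B) 1 q ≡ none
  col-1-into-B K<q q< = SO.col-crossingˡ (s≤s (s≤s z≤n)) K<q q<

  col-1-K : col (nodeConfig g A x B) 1 K ≡ glue (col (πgen g) 1 2) (col A 1 (suc (suc x)))
  col-1-K = trans (SO.col-before (s≤s (s≤s z≤n)) ≤-refl) SI.col-glued

  col-A : ∀ u v → u < v → v ≤ suc x → 0 < u ⊎ v < suc x →
          col (nodeConfig g A x B) (suc u) (suc v) ≡ col A (suc u) (suc v)
  col-A u v u<v v≤ not-base = trans (SO.col-before (s≤s u<v) (s≤s v≤)) (SI.col-inside u v u<v v≤ not-base)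

  col-K-end : col (nodeConfig g A x B) K (K + suc y) ≡ glue (col (πgen g) 2 3) (col B 1 (suc (suc y)))
  col-K-end = trans SO.col-glued (cong (λ c → glue c (col B 1 (suc (suc y)))) (SI.col-after 2 3 (s≤s ≤-refl) ≤-refl))

  col-B : ∀ u v → u < v → v ≤ suc y → 0 < u ⊎ v < suc y →
          col (nodeConfig g A x B) (K + u) (K + v) ≡ col B (suc u) (suc v)
  col-B = SO.col-inside

base-π : ∀ t → col (π t) 1 (suc (suc (nodes t))) ≡ baseColour t
base-π leaf = refl
base-π (node α l r) = trans (cong (λ C → col C 1 (suc (suc (nodes (node α l r))))) (π-node α l r))
  (NodeConfig.col-base α (π l) (nodes l) (π r) (nodes r) (size-π l) (size-π r))
base-π (node β l r) = trans (cong (λ C → col C 1 (suc (suc (nodes (node β l r))))) (π-node β l r))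
  (NodeConfig.col-base β (π l) (nodes l) (π r) (nodes r) (size-π l) (size-π r))

base-π-notRed : ∀ t → NotRed (col (π t) 1 (suc (suc (nodes t))))
base-π-notRed t = subst NotRed (sym (base-π t)) (baseColour-notRed t)

data GraftPosition (l r : Tree) : ℕ → Set where
  inLeft  : ∀ {i} → 1 ≤ i → i ≤ arity l → GraftPosition l r i
  inRight : ∀ k → 1 ≤ k → k ≤ arity r → GraftPosition l r (arity l + k)

graftPosition : ∀ l r i → 1 ≤ i → i ≤ arity l + arity r → GraftPosition l r i
graftPosition l r i 1≤i i≤ with i ≤? arity l
... | yes i≤l = inLeft 1≤i i≤l
... | no i≰l = subst (GraftPosition l r) (m+[n∸m]≡n (<⇒≤ l<i))
    (inRight (i ∸ arity l) (m<n⇒0<n∸m l<i) (subst (i ∸ arity l ≤_) (m+n∸m≡n (arity l) (arity r)) (∸-monoˡ-≤ (arity l) i≤)))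
  where
  l<i : arity l < i
  l<i = ≰⇒> i≰l

graft-inLeft : ∀ g l r {i} u → i ≤ arity l → graft (node g l r) i u ≡ node g (graft l i u) r
graft-inLeft g l r u i≤l = if-true (≤⇒≤ᵇ≡true i≤l)

graft-inRight : ∀ g l r k u → 1 ≤ k → graft (node g l r) (arity l + k) u ≡ node g l (graft r k u)
graft-inRight g l r k u 1≤k = trans (if-false (>⇒≤ᵇ≡false (m<m+n (arity l) 1≤k)))
  (cong (λ n → node g l (graft r n u)) (m+n∸m≡n (arity l) k))

nodes-graft : ∀ s i u → 1 ≤ i → i ≤ arity s → nodes (graft s i u) ≡ nodes s + nodes u
nodes-graft leaf .1 u (s≤s z≤n) (s≤s z≤n) = refl
nodes-graft (node g l r) i u 1≤i i≤ with graftPosition l r i 1≤i i≤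
... | inLeft 1≤i i≤l = trans (cong nodes (graft-inLeft g l r u i≤l))
      (cong suc (trans (cong (_+ nodes r) (nodes-graft l i u 1≤i i≤l)) (xy∙z≈xz∙y (nodes l) (nodes u) (nodes r))))
... | inRight k 1≤k k≤r = trans (cong nodes (graft-inRight g l r k u 1≤k))
      (cong suc (trans (cong (nodes l +_) (nodes-graft r k u 1≤k k≤r)) (sym (+-assoc (nodes l) (nodes r) (nodes u)))))

πgen-identityʳ : ∀ g → πgen g ∘[ 1 ] unitC ≃ πgen g
πgen-identityʳ g = ∘-identityʳ (πgen g) 1 ≤-refl (1≤size-πgen g) (edge₁-notRed g)

π-graft-inLeft : ∀ g l r i u → 1 ≤ i → i ≤ arity l → π (graft l i u) ≃ π l ∘[ i ] π u →
                 π (node g (graft l i u) r) ≃ π (node g l r) ∘[ i ] π u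
π-graft-inLeft g leaf r .1 u (s≤s z≤n) (s≤s z≤n) _ = begin
  π (node g u r)                           ≡⟨ π-node g u r ⟩
  (G ∘[ 1 ] π u) ∘[ 2 + nodes u ] π r      ≈⟨ ∘-parallel G (π u) (π r) 1 2 (nodes u) (nodes r) (size-π u) (size-π r) ≤-refl ⟩
  (G ∘[ 2 ] π r) ∘[ 1 ] π u                ≈⟨ ∘-congˡ 1 (π u) (nodes u) ≤-refl 1≤ (size-π u) (≃-sym unit-in-G) ⟩
  ((G ∘[ 1 ] unitC) ∘[ 2 ] π r) ∘[ 1 ] π u ∎
  where
  G : Config
  G = πgen g
  1≤ : 1 ≤ size (G ∘[ 2 ] π r)
  1≤ = subst (1 ≤_) (sym (trans (size-∘ G (π r) {2} (nodes r) (size-π r)) (cong (_+ nodes r) (size-πgen g)))) (s≤s z≤n)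
  unit-in-G : (G ∘[ 1 ] unitC) ∘[ 2 ] π r ≃ G ∘[ 2 ] π r
  unit-in-G = ∘-congˡ 2 (π r) (nodes r) (s≤s z≤n) (≤-reflexive (sym (size-πgen∘ g unitC 0 refl))) (size-π r)
                (πgen-identityʳ g)
π-graft-inLeft g l@(node _ _ _) r (suc i') u _ i≤l ih = begin
  π (node g (graft l i u) r)                           ≡⟨ π-node g (graft l i u) r ⟩
  nodeConfig g (π (graft l i u)) (nodes (graft l i u)) (π r)
                                                       ≡⟨ cong (λ x → nodeConfig g (π (graft l i u)) x (π r)) nodes-lu ⟩
  nodeConfig g (π (graft l i u)) (nodes l + nodes u) (π r)
                                                       ≈⟨ nodeConfig-congˡ g (nodes l + nodes u) (π r) (nodes r) size-graft (size-π r) ih ⟩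
  (G ∘[ 1 ] (π l ∘[ i ] π u)) ∘[ K + nodes u ] π r     ≈⟨ ∘-congˡ (K + nodes u) (π r) (nodes r) (s≤s z≤n) K+≤ (size-π r) (≃-sym sequential) ⟩
  ((G ∘[ 1 ] π l) ∘[ i ] π u) ∘[ K + nodes u ] π r     ≈⟨ ∘-parallel (G ∘[ 1 ] π l) (π u) (π r) i K (nodes u) (nodes r)
                                                            (size-π u) (size-π r) (s≤s (s≤s i'≤)) ⟩
  ((G ∘[ 1 ] π l) ∘[ K ] π r) ∘[ i ] π u               ≡⟨ cong (_∘[ i ] π u) (π-node g l r) ⟨
  π (node g l r) ∘[ i ] π u                            ∎
  where
  G : Config
  G = πgen g
  i K : ℕ
  i = suc i'
  K = suc (suc (nodes l))
  i'≤ : i' ≤ nodes l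
  i'≤ = ≤-pred (subst (i ≤_) (arity≡suc-nodes l) i≤l)
  nodes-lu : nodes (graft l i u) ≡ nodes l + nodes u
  nodes-lu = nodes-graft l i u (s≤s z≤n) i≤l
  size-graft : size (π (graft l i u)) ≡ suc (nodes l + nodes u)
  size-graft = trans (size-π (graft l i u)) (cong suc nodes-lu)
  sequential : (G ∘[ 1 ] π l) ∘[ i ] π u ≃ G ∘[ 1 ] (π l ∘[ i ] π u)
  sequential = ∘-sequential G (π l) (π u) 1 i' (nodes l) (nodes u) (size-π l) (size-π u) (s≤s z≤n) i'≤
  K+≤ : K + nodes u ≤ size (G ∘[ 1 ] (π l ∘[ i ] π u))
  K+≤ = ≤-reflexive (sym (size-πgen∘ g (π l ∘[ i ] π u) (nodes l + nodes u)
          (trans (size-∘ (π l) (π u) {i} (nodes u) (size-π u)) (cong (_+ nodes u) (size-π l)))))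

π-graft-inRight : ∀ g l r k u → 1 ≤ k → k ≤ arity r → π (graft r k u) ≃ π r ∘[ k ] π u →
                  π (node g l (graft r k u)) ≃ π (node g l r) ∘[ arity l + k ] π u
π-graft-inRight g l r (suc j') u _ k≤r ih =
  subst (λ n → π (node g l (graft r (suc j') u)) ≃ π (node g l r) ∘[ n ] π u) (sym index) (shifted r k≤r ih)
  where
  K : ℕ
  K = suc (suc (nodes l))
  X : Config
  X = πgen g ∘[ 1 ] π l
  index : arity l + suc j' ≡ K + j'
  index = trans (cong (_+ suc j') (arity≡suc-nodes l)) (cong suc (+-suc (nodes l) j'))
  K≤ : K ≤ size X
  K≤ = ≤-reflexive (sym (size-πgen∘ g (π l) (nodes l) (size-π l)))
  shifted : ∀ r → suc j' ≤ arity r → π (graft r (suc j') u) ≃ π r ∘[ suc j' ] π u →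
            π (node g l (graft r (suc j') u)) ≃ π (node g l r) ∘[ K + j' ] π u
  shifted leaf (s≤s z≤n) _ = begin
    π (node g l u)                   ≡⟨ π-node g l u ⟩
    X ∘[ K ] π u                     ≈⟨ ∘-congˡ K (π u) (nodes u) (s≤s z≤n) K≤ (size-π u) (≃-sym X-unit) ⟩
    (X ∘[ K ] unitC) ∘[ K ] π u      ≡⟨ cong₂ (λ C n → C ∘[ n ] π u) (sym (π-node g l leaf)) (sym (+-identityʳ K)) ⟩
    π (node g l leaf) ∘[ K + 0 ] π u ∎
    where
    X-unit : X ∘[ K ] unitC ≃ X
    X-unit = ∘-identityʳ X K (s≤s z≤n) K≤
      (subst NotRed (sym (Composite.col-after (πgen g) (π l) 1 (nodes l) (size-π l) 2 3 (s≤s ≤-refl) ≤-refl))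
             (edge₂-notRed g))
  shifted r@(node _ _ _) k≤r ih = begin
    π (node g l (graft r (suc j') u)) ≡⟨ π-node g l (graft r (suc j') u) ⟩
    X ∘[ K ] π (graft r (suc j') u)   ≈⟨ ∘-congʳ X K (nodes (graft r (suc j') u)) (s≤s z≤n) K≤ (size-π _) ih ⟩
    X ∘[ K ] (π r ∘[ suc j' ] π u)    ≈⟨ ∘-sequential X (π r) (π u) K j' (nodes r) (nodes u) (size-π r) (size-π u) (s≤s z≤n)
                                           (≤-pred (subst (suc j' ≤_) (arity≡suc-nodes r) k≤r)) ⟨
    (X ∘[ K ] π r) ∘[ K + j' ] π u    ≡⟨ cong (_∘[ K + j' ] π u) (sym (π-node g l r)) ⟩
    π (node g l r) ∘[ K + j' ] π u    ∎

π-graft : ∀ s i u → 1 ≤ i → i ≤ arity s → π (graft s i u) ≃ π s ∘[ i ] π u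
π-graft leaf .1 u (s≤s z≤n) (s≤s z≤n) = ≃-sym (∘-identityˡ (π u) (nodes u) (size-π u) (base-π-notRed u))
π-graft (node g l r) i u 1≤i i≤ with graftPosition l r i 1≤i i≤
... | inLeft 1≤i i≤l = begin
  π (graft (node g l r) i u) ≡⟨ cong π (graft-inLeft g l r u i≤l) ⟩
  π (node g (graft l i u) r) ≈⟨ π-graft-inLeft g l r i u 1≤i i≤l (π-graft l i u 1≤i i≤l) ⟩
  π (node g l r) ∘[ i ] π u  ∎
... | inRight k 1≤k k≤r = begin
  π (graft (node g l r) (arity l + k) u) ≡⟨ cong π (graft-inRight g l r k u 1≤k) ⟩
  π (node g l (graft r k u))             ≈⟨ π-graft-inRight g l r k u 1≤k k≤r (π-graft r k u 1≤k k≤r) ⟩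
  π (node g l r) ∘[ arity l + k ] π u    ∎

IsArc₂-elim : ∀ {P : ℕ → ℕ → Set} → P 1 2 → P 1 3 → P 2 3 → ∀ p q → IsArc 2 p q → P p q
IsArc₂-elim p₁₂ p₁₃ p₂₃ 1 2 _ = p₁₂
IsArc₂-elim p₁₂ p₁₃ p₂₃ 1 3 _ = p₁₃
IsArc₂-elim p₁₂ p₁₃ p₂₃ 2 3 _ = p₂₃
IsArc₂-elim _ _ _ 0 _ (() , _)
IsArc₂-elim _ _ _ 1 0 (_ , () , _)
IsArc₂-elim _ _ _ 1 1 (_ , s≤s () , _)
IsArc₂-elim _ _ _ 2 0 (_ , () , _)
IsArc₂-elim _ _ _ 2 1 (_ , s≤s () , _)
IsArc₂-elim _ _ _ 2 2 (_ , s≤s (s≤s ()) , _)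
IsArc₂-elim _ _ _ (suc (suc (suc p))) _ (_ , s≤s (s≤s (s≤s (s≤s _))) , s≤s (s≤s (s≤s ())))
IsArc₂-elim _ _ _ (suc p) (suc (suc (suc (suc q)))) (_ , _ , s≤s (s≤s (s≤s ())))

IsArc₃-elim : ∀ {P : ℕ → ℕ → Set} → P 1 2 → P 1 3 → P 1 4 → P 2 3 → P 2 4 → P 3 4 → ∀ p q → IsArc 3 p q → P p q
IsArc₃-elim p₁₂ _ _ _ _ _ 1 2 _ = p₁₂
IsArc₃-elim _ p₁₃ _ _ _ _ 1 3 _ = p₁₃
IsArc₃-elim _ _ p₁₄ _ _ _ 1 4 _ = p₁₄
IsArc₃-elim _ _ _ p₂₃ _ _ 2 3 _ = p₂₃
IsArc₃-elim _ _ _ _ p₂₄ _ 2 4 _ = p₂₄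
IsArc₃-elim _ _ _ _ _ p₃₄ 3 4 _ = p₃₄
IsArc₃-elim _ _ _ _ _ _ 0 _ (() , _)
IsArc₃-elim _ _ _ _ _ _ 1 0 (_ , () , _)
IsArc₃-elim _ _ _ _ _ _ 1 1 (_ , s≤s () , _)
IsArc₃-elim _ _ _ _ _ _ 2 0 (_ , () , _)
IsArc₃-elim _ _ _ _ _ _ 2 1 (_ , s≤s () , _)
IsArc₃-elim _ _ _ _ _ _ 2 2 (_ , s≤s (s≤s ()) , _)
IsArc₃-elim _ _ _ _ _ _ 3 0 (_ , () , _)
IsArc₃-elim _ _ _ _ _ _ 3 1 (_ , s≤s () , _)
IsArc₃-elim _ _ _ _ _ _ 3 2 (_ , s≤s (s≤s ()) , _)
IsArc₃-elim _ _ _ _ _ _ 3 3 (_ , s≤s (s≤s (s≤s ())) , _)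
IsArc₃-elim _ _ _ _ _ _ (suc (suc (suc (suc p)))) _ (_ , s≤s (s≤s (s≤s (s≤s (s≤s _)))) , s≤s (s≤s (s≤s (s≤s ()))))
IsArc₃-elim _ _ _ _ _ _ (suc p) (suc (suc (suc (suc (suc q))))) (_ , _ , s≤s (s≤s (s≤s (s≤s ()))))

π-ax-β : π (graft (gen β) 1 (gen β)) ≃ π (graft (gen β) 2 (gen β))
π-ax-β = ≃-intro (refl , IsArc₃-elim refl refl refl refl refl refl)

π-ax-α : π (graft (gen α) 1 (gen α)) ≃ π (graft (gen α) 2 (gen β))
π-ax-α = ≃-intro (refl , IsArc₃-elim refl refl refl refl refl refl)

≤arity⇒≤size-π : ∀ {i} s → i ≤ arity s → i ≤ size (π s)
≤arity⇒≤size-π {i} s = subst (i ≤_) (trans (arity≡suc-nodes s) (sym (size-π s)))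

nodes-resp-π : ∀ s t → π s ≃ π t → nodes s ≡ nodes t
nodes-resp-π s t (≃-intro (size-eq , _)) = suc-injective (trans (sym (size-π s)) (trans size-eq (size-π t)))

arity-resp-π : ∀ s t → π s ≃ π t → arity s ≡ arity t
arity-resp-π s t eq = trans (arity≡suc-nodes s) (trans (cong suc (nodes-resp-π s t eq)) (sym (arity≡suc-nodes t)))

π-resp-≈ : ∀ {s t} → s ≈ t → π s ≃ π t
π-resp-≈ ax-β = π-ax-β
π-resp-≈ ax-α = π-ax-α
π-resp-≈ ≈-refl = ≃-refl
π-resp-≈ (≈-sym s≈t) = ≃-sym (π-resp-≈ s≈t)
π-resp-≈ (≈-trans s≈t t≈u) = ≃-trans (π-resp-≈ s≈t) (π-resp-≈ t≈u)
π-resp-≈ (≈-comp {s} {s'} {t} {t'} i 1≤i i≤ s≈s' t≈t') = begin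
  π (graft s i t)    ≈⟨ π-graft s i t 1≤i i≤ ⟩
  π s ∘[ i ] π t     ≈⟨ ∘-cong i (nodes t) 1≤i (≤arity⇒≤size-π s i≤) (size-π t) πs≃πs' (π-resp-≈ t≈t') ⟩
  π s' ∘[ i ] π t'   ≈⟨ π-graft s' i t' 1≤i (subst (i ≤_) (arity-resp-π s s' πs≃πs') i≤) ⟨
  π (graft s' i t')  ∎
  where
  πs≃πs' : π s ≃ π s'
  πs≃πs' = π-resp-≈ s≈s'

πgen-InGen : ∀ g → InGen (πgen g)
πgen-InGen α = gen-baa
πgen-InGen β = gen-aba

π-InGen : ∀ t → InGen (π t)
π-InGen leaf = gen-unit
π-InGen (node g l r) = gen-comp (suc (arity l)) (s≤s z≤n)
  (subst (suc (arity l) ≤_) (sym (size-πgen∘ g (π l) (nodes l) (size-π l))) (s≤s (≤-reflexive (arity≡suc-nodes l))))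
  (gen-comp 1 ≤-refl (1≤size-πgen g) (πgen-InGen g) (π-InGen l)) (π-InGen r)

InGen⇒image : ∀ C → InGen C → Σ Tree (λ t → π t ≃ C)
InGen⇒image _ gen-unit = leaf , ≃-refl
InGen⇒image _ gen-baa  = gen α , ≃-intro (refl , IsArc₂-elim refl refl refl)
InGen⇒image _ gen-aba  = gen β , ≃-intro (refl , IsArc₂-elim refl refl refl)
InGen⇒image _ (gen-comp {C} {D} i 1≤i i≤ C-gen D-gen) with InGen⇒image C C-gen | InGen⇒image D D-gen
... | t , πt≃C | u , πu≃D = graft t i u , (begin
  π (graft t i u) ≈⟨ π-graft t i u 1≤i i≤arity-t ⟩
  π t ∘[ i ] π u  ≈⟨ ∘-cong i (nodes u) 1≤i (≤arity⇒≤size-π t i≤arity-t) (size-π u) πt≃C πu≃D ⟩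
  C ∘[ i ] D      ∎)
  where
  i≤arity-t : i ≤ arity t
  i≤arity-t = subst (i ≤_) (trans (sym (proj₁ (≃⇒≐ πt≃C))) (trans (size-π t) (sym (arity≡suc-nodes t)))) i≤

-- Injectivity on normal trees

glue-injectiveʳ : ∀ {c x y} → NotRed c → NotRed x → NotRed y → glue c x ≡ glue c y → x ≡ y
glue-injectiveʳ blue-nr x-nr y-nr eq = trans (sym (glue-blueˡ x-nr)) (trans eq (glue-blueˡ y-nr))
glue-injectiveʳ none-nr blue-nr blue-nr _ = refl
glue-injectiveʳ none-nr none-nr none-nr _ = refl
glue-injectiveʳ none-nr blue-nr none-nr ()
glue-injectiveʳ none-nr none-nr blue-nr ()

≃-from-arcs : ∀ {A A' x} → size A ≡ suc x → size A' ≡ suc x →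
              (∀ u v → u < v → v ≤ suc x → col A (suc u) (suc v) ≡ col A' (suc u) (suc v)) → A ≃ A'
≃-from-arcs {A} {A'} size-A size-A' same = ≃-intro (trans size-A (sym size-A') , arcs)
  where
  arcs : ∀ p q → IsArc (size A) p q → col A p q ≡ col A' p q
  arcs (suc u) (suc v) (_ , s≤s u<v , q≤) = same u v u<v (≤-pred (subst (λ n → suc v ≤ suc n) size-A q≤))

base-or-inner : ∀ {u v n} → u < v → v ≤ suc n → (u ≡ 0 × v ≡ suc n) ⊎ (0 < u ⊎ v < suc n)
base-or-inner {suc u} _ _ = inj₂ (inj₁ (s≤s z≤n))
base-or-inner {zero} _ v≤ with m≤n⇒m<n∨m≡n v≤
... | inj₁ v< = inj₂ (inj₂ v<)
... | inj₂ v≡ = inj₁ (refl , v≡)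

module NodeConfigInjective (g : Gen₂) (A A' B B' : Config) (x y : ℕ)
         (size-A : size A ≡ suc x) (size-A' : size A' ≡ suc x) (size-B : size B ≡ suc y) (size-B' : size B' ≡ suc y)
         (base-A : NotRed (col A 1 (suc (suc x)))) (base-A' : NotRed (col A' 1 (suc (suc x))))
         (base-B : NotRed (col B 1 (suc (suc y)))) (base-B' : NotRed (col B' 1 (suc (suc y))))
         (N≃N' : nodeConfig g A x B ≃ nodeConfig g A' x B') where
  private
    module N  = NodeConfig g A x B y size-A size-B
    module N' = NodeConfig g A' x B' y size-A' size-B'
    K : ℕ
    K = suc (suc x)
    N-arc : ∀ p q → IsArc (suc (suc (x + y))) p q →
            col (nodeConfig g A x B) p q ≡ col (nodeConfig g A' x B') p q
    N-arc p q arc = proj₂ (≃⇒≐ N≃N') p q (IsArc-resp (sym (size-nodeConfig g A x B y size-A size-B)) arc)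

  A≃A' : A ≃ A'
  A≃A' = ≃-from-arcs size-A size-A' same
    where
    A-arc : ∀ {u v} → u < v → v ≤ suc x → IsArc (suc (suc (x + y))) (suc u) (suc v)
    A-arc u<v v≤ = s≤s z≤n , s≤s u<v , s≤s (≤-trans v≤ (s≤s (≤-trans (m≤m+n x y) (n≤1+n (x + y)))))
    same : ∀ u v → u < v → v ≤ suc x → col A (suc u) (suc v) ≡ col A' (suc u) (suc v)
    same u v u<v v≤ with base-or-inner u<v v≤
    ... | inj₂ inner = trans (sym (N.col-A u v u<v v≤ inner))
          (trans (N-arc (suc u) (suc v) (A-arc u<v v≤)) (N'.col-A u v u<v v≤ inner))
    ... | inj₁ (refl , refl) = glue-injectiveʳ (edge₁-notRed g) base-A base-A'
          (trans (sym N.col-1-K) (trans (N-arc 1 K (A-arc u<v v≤)) N'.col-1-K))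

  B≃B' : B ≃ B'
  B≃B' = ≃-from-arcs size-B size-B' same
    where
    B-arc : ∀ {u v} → u < v → v ≤ suc y → IsArc (suc (suc (x + y))) (K + u) (K + v)
    B-arc {v = v} u<v v≤ = s≤s z≤n , +-monoʳ-< K u<v ,
      subst (K + v ≤_) (cong (λ z → suc (suc z)) (+-suc x y)) (+-monoʳ-≤ K v≤)
    same : ∀ u v → u < v → v ≤ suc y → col B (suc u) (suc v) ≡ col B' (suc u) (suc v)
    same u v u<v v≤ with base-or-inner u<v v≤
    ... | inj₂ inner = trans (sym (N.col-B u v u<v v≤ inner))
          (trans (N-arc (K + u) (K + v) (B-arc u<v v≤)) (N'.col-B u v u<v v≤ inner))
    ... | inj₁ (refl , refl) = glue-injectiveʳ (edge₂-notRed g) base-B base-B'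
          (trans (sym N.col-K-end) (trans (N-arc K (K + suc y) (subst (λ k → IsArc (suc (suc (x + y))) k (K + suc y)) (+-identityʳ K) (B-arc u<v v≤)))
                 N'.col-K-end))

-- node g l r with l a node of the same label is the left-hand side of a defining relation
NoRedex : Gen₂ → Tree → Set
NoRedex _ leaf         = ⊤
NoRedex α (node α _ _) = ⊥
NoRedex α (node β _ _) = ⊤
NoRedex β (node α _ _) = ⊤
NoRedex β (node β _ _) = ⊥

data Normal : Tree → Set where
  leaf : Normal leaf
  node : ∀ {g l r} → NoRedex g l → Normal l → Normal r → Normal (node g l r)

NoRedex⇒glue-coloured : ∀ g l → NoRedex g l → 0 < nodes l → glue (col (πgen g) 1 2) (baseColour l) ≢ none
NoRedex⇒glue-coloured α (node β _ _) _ _ ()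
NoRedex⇒glue-coloured β (node α _ _) _ _ ()

πgen-injective : ∀ g g' → col (πgen g) 1 3 ≡ col (πgen g') 1 3 → g ≡ g'
πgen-injective α α _ = refl
πgen-injective β β _ = refl

π-node-≃ : ∀ g l r g' l' r' → π (node g l r) ≃ π (node g' l' r') →
           nodeConfig g (π l) (nodes l) (π r) ≃ nodeConfig g' (π l') (nodes l') (π r')
π-node-≃ g l r g' l' r' eq = begin
  nodeConfig g (π l) (nodes l) (π r)     ≡⟨ π-node g l r ⟨
  π (node g l r)                         ≈⟨ eq ⟩
  π (node g' l' r')                      ≡⟨ π-node g' l' r' ⟩
  nodeConfig g' (π l') (nodes l') (π r') ∎

label-resp-π : ∀ g l r g' l' r' → π (node g l r) ≃ π (node g' l' r') → g ≡ g'
label-resp-π g l r g' l' r' eq = πgen-injective g g'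
  (trans (sym N.col-base) (trans (proj₂ (≃⇒≐ (π-node-≃ g l r g' l' r' eq)) 1 _ base)
    (trans (cong (λ n → col (nodeConfig g' (π l') (nodes l') (π r')) 1 (suc (suc n))) same-nodes) N'.col-base)))
  where
  module N  = NodeConfig g (π l) (nodes l) (π r) (nodes r) (size-π l) (size-π r)
  module N' = NodeConfig g' (π l') (nodes l') (π r') (nodes r') (size-π l') (size-π r')
  base : IsArc (size (nodeConfig g (π l) (nodes l) (π r))) 1 (suc (suc (nodes (node g l r))))
  base = IsArc-resp (sym (size-π (node g l r))) (s≤s z≤n , s≤s (s≤s z≤n) , ≤-refl)
  same-nodes : nodes (node g l r) ≡ nodes (node g' l' r')
  same-nodes = nodes-resp-π (node g l r) (node g' l' r') eq

module _ (g : Gen₂) (l r l' r' : Tree) (N≃N' : nodeConfig g (π l) (nodes l) (π r) ≃ nodeConfig g (π l') (nodes l') (π r'))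
         (total : nodes l + nodes r ≡ nodes l' + nodes r') where
  private
    x y x' : ℕ
    x = nodes l ; y = nodes r ; x' = nodes l'
    module N  = NodeConfig g (π l) x (π r) y (size-π l) (size-π r)
    module N' = NodeConfig g (π l') x' (π r') (nodes r') (size-π l') (size-π r')

  -- In π (node g l' r') with NoRedex g l' the arc from 1 to the end of π l' is coloured,
  -- while in π (node g l r) the arcs from 1 into π r are not.
  left-nodes-≮ : NoRedex g l' → x < x' → ⊥
  left-nodes-≮ no-redex x<x' = NoRedex⇒glue-coloured g l' no-redex (≤-trans (s≤s z≤n) x<x')
    (trans (sym (cong (glue (col (πgen g) 1 2)) (base-π l')))
      (trans (sym N'.col-1-K) (trans (sym (proj₂ (≃⇒≐ N≃N') 1 K' arc)) (N.col-1-into-B (s≤s (s≤s x<x')) K'<))))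
    where
    K' : ℕ
    K' = suc (suc x')
    K'≤ : K' ≤ suc (suc (x + y))
    K'≤ = s≤s (s≤s (subst (x' ≤_) (sym total) (m≤m+n x' (nodes r'))))
    K'< : K' < suc (suc x) + suc y
    K'< = subst (K' <_) (cong (λ z → suc (suc z)) (sym (+-suc x y))) (s≤s K'≤)
    arc : IsArc (size (nodeConfig g (π l) x (π r))) 1 K'
    arc = IsArc-resp (sym (size-nodeConfig g (π l) x (π r) y (size-π l) (size-π r)))
            (s≤s z≤n , s≤s (s≤s z≤n) , ≤-trans K'≤ (n≤1+n _))

π-node-injective : ∀ g l r l' r' → NoRedex g l → NoRedex g l' → π (node g l r) ≃ π (node g l' r') →
                   π l ≃ π l' × π r ≃ π r'
π-node-injective g l r l' r' no-redex no-redex' eq = S.A≃A' , S.B≃B'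
  where
  N≃N' : nodeConfig g (π l) (nodes l) (π r) ≃ nodeConfig g (π l') (nodes l') (π r')
  N≃N' = π-node-≃ g l r g l' r' eq
  total : nodes l + nodes r ≡ nodes l' + nodes r'
  total = suc-injective (nodes-resp-π (node g l r) (node g l' r') eq)
  left-eq : nodes l ≡ nodes l'
  left-eq with <-cmp (nodes l) (nodes l')
  ... | tri< lt _ _ = ⊥-elim (left-nodes-≮ g l r l' r' N≃N' total no-redex' lt)
  ... | tri≈ _ e _ = e
  ... | tri> _ _ gt = ⊥-elim (left-nodes-≮ g l' r' l r (≃-sym N≃N') (sym total) no-redex gt)
  right-eq : nodes r ≡ nodes r'
  right-eq = +-cancelˡ-≡ (nodes l) _ _ (trans total (cong (_+ nodes r') (sym left-eq)))
  module S = NodeConfigInjective g (π l) (π l') (π r) (π r') (nodes l) (nodes r)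
    (size-π l) (trans (size-π l') (cong suc (sym left-eq))) (size-π r) (trans (size-π r') (cong suc (sym right-eq)))
    (base-π-notRed l) (subst (λ z → NotRed (col (π l') 1 (suc (suc z)))) (sym left-eq) (base-π-notRed l'))
    (base-π-notRed r) (subst (λ z → NotRed (col (π r') 1 (suc (suc z)))) (sym right-eq) (base-π-notRed r'))
    (subst (λ z → nodeConfig g (π l) (nodes l) (π r) ≃ nodeConfig g (π l') z (π r')) (sym left-eq) N≃N')

π-injective-Normal : ∀ {s t} → Normal s → Normal t → π s ≃ π t → s ≡ t
π-injective-Normal leaf leaf _ = refl
π-injective-Normal {t = t} leaf (node _ _ _) eq = ⊥-elim (0≢1+n (nodes-resp-π leaf t eq))
π-injective-Normal {s = s} (node _ _ _) leaf eq = ⊥-elim (0≢1+n (sym (nodes-resp-π s leaf eq)))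
π-injective-Normal {node g l r} {node g' l' r'} (node nr Nl Nr) (node nr' Nl' Nr') eq
  with label-resp-π g l r g' l' r' eq
... | refl = cong₂ (node g) (π-injective-Normal Nl Nl' (proj₁ split)) (π-injective-Normal Nr Nr' (proj₂ split))
  where
  split : π l ≃ π l' × π r ≃ π r'
  split = π-node-injective g l r l' r' nr nr' eq

-- Normal forms

≈-node : ∀ g {l l' r r'} → l ≈ l' → r ≈ r' → node g l r ≈ node g l' r'
≈-node g l≈l' r≈r' = ≈-comp 1 ≤-refl (s≤s z≤n) (≈-comp {gen g} 2 (s≤s z≤n) ≤-refl ≈-refl r≈r') l≈l'

β-assoc : ∀ x y z → node β (node β x y) z ≈ node β x (node β y z)
β-assoc x y z = ≈-comp 1 (s≤s z≤n) (s≤s z≤n)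
  (≈-comp 2 (s≤s z≤n) (s≤s (s≤s z≤n)) (≈-comp 3 (s≤s z≤n) ≤-refl ax-β (≈-refl {z})) (≈-refl {y})) (≈-refl {x})

α-assoc : ∀ x y z → node α (node α x y) z ≈ node α x (node β y z)
α-assoc x y z = ≈-comp 1 (s≤s z≤n) (s≤s z≤n)
  (≈-comp 2 (s≤s z≤n) (s≤s (s≤s z≤n)) (≈-comp 3 (s≤s z≤n) ≤-refl ax-α (≈-refl {z})) (≈-refl {y})) (≈-refl {x})

nodeβ : Tree → Tree → Tree
nodeβ (node β x y) z = node β x (nodeβ y z)
nodeβ x            z = node β x z

nodeα : Tree → Tree → Tree
nodeα (node α x y) z = nodeα x (nodeβ y z)
nodeα x            z = node α x z

normalize : Tree → Tree
normalize leaf         = leaf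
normalize (node α l r) = nodeα (normalize l) (normalize r)
normalize (node β l r) = nodeβ (normalize l) (normalize r)

nodeβ-≈ : ∀ x z → node β x z ≈ nodeβ x z
nodeβ-≈ leaf         z = ≈-refl
nodeβ-≈ (node α x y) z = ≈-refl
nodeβ-≈ (node β x y) z = ≈-trans (β-assoc x y z) (≈-node β ≈-refl (nodeβ-≈ y z))

nodeα-≈ : ∀ x z → node α x z ≈ nodeα x z
nodeα-≈ leaf         z = ≈-refl
nodeα-≈ (node β x y) z = ≈-refl
nodeα-≈ (node α x y) z = ≈-trans (α-assoc x y z) (≈-trans (≈-node α ≈-refl (nodeβ-≈ y z)) (nodeα-≈ x (nodeβ y z)))

normalize-≈ : ∀ t → t ≈ normalize t
normalize-≈ leaf         = ≈-refl
normalize-≈ (node α l r) = ≈-trans (≈-node α (normalize-≈ l) (normalize-≈ r)) (nodeα-≈ (normalize l) (normalize r))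
normalize-≈ (node β l r) = ≈-trans (≈-node β (normalize-≈ l) (normalize-≈ r)) (nodeβ-≈ (normalize l) (normalize r))

nodeβ-Normal : ∀ {x z} → Normal x → Normal z → Normal (nodeβ x z)
nodeβ-Normal {leaf}       Nx Nz = node tt Nx Nz
nodeβ-Normal {node α _ _} Nx Nz = node tt Nx Nz
nodeβ-Normal {node β _ _} (node nr Nx Ny) Nz = node nr Nx (nodeβ-Normal Ny Nz)

nodeα-Normal : ∀ {x z} → Normal x → Normal z → Normal (nodeα x z)
nodeα-Normal {leaf}       Nx Nz = node tt Nx Nz
nodeα-Normal {node β _ _} Nx Nz = node tt Nx Nz
nodeα-Normal {node α _ _} (node _ Nx Ny) Nz = nodeα-Normal Nx (nodeβ-Normal Ny Nz)

normalize-Normal : ∀ t → Normal (normalize t)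
normalize-Normal leaf         = leaf
normalize-Normal (node α l r) = nodeα-Normal (normalize-Normal l) (normalize-Normal r)
normalize-Normal (node β l r) = nodeβ-Normal (normalize-Normal l) (normalize-Normal r)

π-reflects-≈ : ∀ s t → π s ≐ π t → s ≈ t
π-reflects-≈ s t πs≐πt = ≈-trans (subst (s ≈_) same-nf (normalize-≈ s)) (≈-sym (normalize-≈ t))
  where
  same-nf : normalize s ≡ normalize t
  same-nf = π-injective-Normal (normalize-Normal s) (normalize-Normal t)
    (≃-trans (≃-sym (π-resp-≈ (normalize-≈ s))) (≃-trans (≃-intro πs≐πt) (π-resp-≈ (normalize-≈ t))))

mainTheorem18 : ((s t : Tree) → (s ≈ t → π s ≐ π t) × (π s ≐ π t → s ≈ t))
    × ((t : Tree) → InGen (π t))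
    × ((C : Config) → InGen C → Σ Tree (λ t → π t ≐ C))
mainTheorem18 =
  (λ s t → (λ s≈t → ≃⇒≐ (π-resp-≈ s≈t)) , π-reflects-≈ s t) ,
  π-InGen ,
  (λ C C-gen → let (t , πt≃C) = InGen⇒image C C-gen in t , ≃⇒≐ πt≃C)
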